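{- Let $G=(V,E)$ be a network with $n=|V|$ vertices and diameter $D$. In $O(D+\log n)$ rounds of the $\mathsf{CONGEST}$ model one can compute an identifier assignment $\mathrm{ID}:V\to\{1,\ldots,|V|\}$ (a bijection), together with additional information stored at the vertices, such that $\mathrm{ID}(u)<\mathrm{ID}(v)$ implies $\lfloor\log\deg(u)\rfloor\le\lfloor\log\deg(v)\rfloor$, and any vertex $u$ can locally compute $\lfloor\log\deg(v)\rfloor$ for any vertex $v$ from $\mathrm{ID}(v)$.
   Context: The $\mathsf{CONGEST}$ model: each vertex initially has a distinct $\Theta(\log n)$-bit identifier and knows its incident edges; in each synchronous round each vertex may do unlimited local computation and send a distinct $O(\log n)$-bit message to each neighbor. $\log$ is base 2. -}

module Defs where

open import Data.Nat using (ℕ; zero; suc; _+_; _*_; _^_; _≤_; _<_)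
open import Data.Nat.Logarithm using (⌊log₂_⌋)
open import Data.Bool using (Bool; T)
open import Data.Fin using (Fin)
open import Data.List using (List; map; length; filterᵇ; allFin)
open import Data.Maybe using (Maybe; just)
open import Data.Product using (_×_; _,_; ∃; ∃-syntax)
open import Function using (Injective)
open import Relation.Nullary using (¬_)
open import Relation.Binary.PropositionalEquality using (_≡_)

record Graph (n : ℕ) : Set where
  field
    adj     : Fin n → Fin n → Bool
    adj-sym : ∀ u v → adj u v ≡ adj v u
    irrefl  : ∀ v → ¬ T (adj v v)
open Graph public

module _ {n : ℕ} (G : Graph n) where

  -- neighbours of v, listed in the (arbitrary) order of the vertex names;
  -- since the theorem quantifies over all graphs, this is an arbitrary
  -- port numbering.
  nbrs : Fin n → List (Fin n)
  nbrs v = filterᵇ (adj G v) (allFin n)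

  deg : Fin n → ℕ
  deg v = length (nbrs v)

  data Walk : Fin n → Fin n → ℕ → Set where
    here : ∀ {u} → Walk u u 0
    step : ∀ {u w v k} → T (adj G u w) → Walk w v k → Walk u v (suc k)

  Dist≤ : Fin n → Fin n → ℕ → Set
  Dist≤ u v d = ∃[ k ] (k ≤ d × Walk u v k)

  IsDiameter : ℕ → Set
  IsDiameter D = (∀ u v → Dist≤ u v D)
               × (∀ d → (∀ u v → Dist≤ u v d) → D ≤ d)

-- A vertex starts knowing its own identifier and the identifiers of its
-- neighbours (its incident edges).  In each round it sends to each
-- neighbour (addressed by that neighbour's identifier) a message, encoded
-- as a natural number, computed from its state; it then receives the list
-- of (sender identifier, message) pairs and updates its state by an
-- arbitrary function (unlimited local computation).  The output of a
-- vertex (if it has produced one) is read off its state.  `Info` is the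
-- type of the "additional information" stored at vertices, and `decode`
-- is the local computation a vertex performs on its stored information
-- and an identifier.

record Algorithm : Set₁ where
  field
    State  : Set
    Info   : Set
    init   : ℕ → List ℕ → State
    send   : State → ℕ → ℕ
    recv   : State → List (ℕ × ℕ) → State
    out    : State → Maybe (ℕ × Info)
    decode : Info → ℕ → ℕ
open Algorithm public

module Run (A : Algorithm) {n : ℕ} (G : Graph n) (ids : Fin n → ℕ) where

  nbrIds : Fin n → List ℕ
  nbrIds v = map ids (nbrs G v)

  state : ℕ → Fin n → State A
  state zero    v = init A (ids v) (nbrIds v)
  state (suc r) v =
    recv A (state r v)
      (map (λ w → ids w , send A (state r w) (ids v)) (nbrs G v))

  -- message sent from w to v in round r+1
  msg : ℕ → Fin n → Fin n → ℕ
  msg r w v = send A (state r w) (ids v)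

-- O(log n)-bit quantities, with constant c: less than 2^(c (⌊log n⌋+1)).

Bits≤ : ℕ → ℕ → ℕ → Set
Bits≤ c n x = x < 2 ^ (c * (⌊log₂ n ⌋ + 1))

module Submission where

-- Phases i = 0, 1, … use the guess g = 2^i for max(D, ⌊log n⌋); a phase takes O(g) rounds:
-- flooding the minimum identifier for g rounds (the round of the last change is the BFS
-- depth below the leader, a neighbour one level up with the same minimum is the parent),
-- a convergecast of the numbers cnt j v of class-j vertices (j = ⌊log deg⌋ ≤ g) in every
-- subtree, and a broadcast of the class sizes and of DFS-like subtree offsets off j v.
-- A class-j vertex takes ID = 1 + (sizes of classes < j) + (its offset) and stores the
-- class sizes, which decode the class of any ID.  Once g ≥ max(D, ⌊log n⌋) a phase is
-- correct and all later phases agree with it; by doubling this takes O(D + log n) rounds.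

open import Defs
open import Data.Nat using (ℕ; zero; suc; _+_; _*_; _≤_; _<_)
open import Data.Nat.Logarithm using (⌊log₂_⌋)
open import Data.Bool using (T)
open import Data.Fin using (Fin)
open import Data.Maybe using (just)
open import Data.Product using (_×_; _,_; ∃; ∃-syntax; Σ-syntax)
open import Function using (Injective)
open import Relation.Binary.PropositionalEquality using (_≡_)

module BoolComparisons where

  open import Data.Nat
  open import Data.Nat.Properties
  open import Data.Bool using (Bool; true; false; T; _∧_; if_then_else_)
  open import Data.Product using (_×_; _,_)
  open import Data.Unit using (tt)
  open import Data.Empty using (⊥-elim)
  open import Relation.Binary.PropositionalEquality
  open import Relation.Nullary using (¬_)

  ≡ᵇ-sound : ∀ {m n} → (m ≡ᵇ n) ≡ true → m ≡ n
  ≡ᵇ-sound {m} {n} e = ≡ᵇ⇒≡ m n (subst T (sym e) tt)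

  ≡ᵇ-false : ∀ {m n} → (m ≡ᵇ n) ≡ false → m ≢ n
  ≡ᵇ-false {m} {n} e m≡n with ≡⇒≡ᵇ m n m≡n
  ... | t rewrite e = t

  ≡ᵇ-refl : ∀ m → (m ≡ᵇ m) ≡ true
  ≡ᵇ-refl zero = refl
  ≡ᵇ-refl (suc m) = ≡ᵇ-refl m

  ≡ᵇ-≢ : ∀ {m n} → m ≢ n → (m ≡ᵇ n) ≡ false
  ≡ᵇ-≢ {m} {n} ne with m ≡ᵇ n in e
  ... | true = ⊥-elim (ne (≡ᵇ-sound e))
  ... | false = refl

  ≤ᵇ-sound : ∀ {m n} → (m ≤ᵇ n) ≡ true → m ≤ n
  ≤ᵇ-sound {m} {n} e = ≤ᵇ⇒≤ m n (subst T (sym e) tt)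

  ≤ᵇ-true : ∀ {m n} → m ≤ n → (m ≤ᵇ n) ≡ true
  ≤ᵇ-true {m} {n} p with m ≤ᵇ n in e
  ... | true = refl
  ... | false = ⊥-elim (subst T e (≤⇒≤ᵇ p))

  ≤ᵇ-false : ∀ {m n} → ¬ (m ≤ n) → (m ≤ᵇ n) ≡ false
  ≤ᵇ-false {m} {n} p with m ≤ᵇ n in e
  ... | true = ⊥-elim (p (≤ᵇ-sound e))
  ... | false = refl

  ∧-true : ∀ {a b} → (a ∧ b) ≡ true → (a ≡ true) × (b ≡ true)
  ∧-true {true} {true} e = refl , refl

  ∧-false : ∀ b → (b ∧ false) ≡ false
  ∧-false true = refl
  ∧-false false = refl

  if-cong : ∀ {b b' : Bool} {x x' y : ℕ} → b ≡ b' → (b' ≡ true → x ≡ x') → (if b then x else y) ≡ (if b' then x' else y)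
  if-cong {b' = true} refl h = h refl
  if-cong {b' = false} refl h = refl

  if-≤ : ∀ (b : Bool) {x B : ℕ} → (b ≡ true → x ≤ B) → (if b then x else 0) ≤ B
  if-≤ true h = h refl
  if-≤ false h = z≤n

-- Cantor pairing: the broadcast stage sends two numbers ≤ n in one O(log n)-bit message.
module CantorPairing where

  open import Data.Nat
  open import Data.Nat.Properties
  open import Data.Product using (_×_; _,_)
  open import Relation.Binary.PropositionalEquality

  triangle : ℕ → ℕ
  triangle zero = 0
  triangle (suc s) = suc s + triangle s

  pair : ℕ → ℕ → ℕ
  pair a b = b + triangle (a + b)

  -- unpairing enumerates ℕ × ℕ along anti-diagonals, starting from (0 , 0)
  cantorStep : ℕ × ℕ → ℕ × ℕ
  cantorStep (zero , b) = (suc b , 0)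
  cantorStep (suc a , b) = (a , suc b)

  cantorIter : ℕ → ℕ × ℕ → ℕ × ℕ
  cantorIter zero x = x
  cantorIter (suc m) x = cantorStep (cantorIter m x)

  unpair : ℕ → ℕ × ℕ
  unpair x = cantorIter x (0 , 0)

  cantorIter-+ : ∀ k m x → cantorIter (k + m) x ≡ cantorIter k (cantorIter m x)
  cantorIter-+ zero m x = refl
  cantorIter-+ (suc k) m x = cong cantorStep (cantorIter-+ k m x)

  cantorIter-diag : ∀ b a → cantorIter b (b + a , 0) ≡ (a , b)
  cantorIter-diag zero a = refl
  cantorIter-diag (suc b) a rewrite sym (+-suc b a) | cantorIter-diag b (suc a) = refl

  cantorIter-triangle : ∀ s → cantorIter (triangle s) (0 , 0) ≡ (s , 0)
  cantorIter-triangle zero = refl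
  cantorIter-triangle (suc s) rewrite cantorIter-+ (suc s) (triangle s) (0 , 0) | cantorIter-triangle s
    | cong (λ z → cantorIter s (z , 0)) (sym (+-identityʳ s)) | cantorIter-diag s 0 = refl

  unpair-pair : ∀ a b → unpair (pair a b) ≡ (a , b)
  unpair-pair a b rewrite cantorIter-+ b (triangle (a + b)) (0 , 0) | cantorIter-triangle (a + b)
    | +-comm a b = cantorIter-diag b a

  triangle-≤ : ∀ s → triangle s ≤ s * s
  triangle-≤ zero = z≤n
  triangle-≤ (suc s) = +-monoʳ-≤ (suc s) (≤-trans (triangle-≤ s) (*-monoʳ-≤ s (n≤1+n s)))

  triangle-mono : ∀ {s t} → s ≤ t → triangle s ≤ triangle t
  triangle-mono {zero} _ = z≤n
  triangle-mono {suc s} {suc t} (s≤s p) = +-mono-≤ (s≤s p) (triangle-mono p)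

  -- the size bound that makes paired messages O(log n) bits
  pair-≤ : ∀ {a b m} → a ≤ m → b ≤ m → pair a b ≤ m + (m + m) * (m + m)
  pair-≤ {a} {b} {m} p q = +-mono-≤ q (≤-trans (triangle-mono (+-mono-≤ p q)) (triangle-≤ (m + m)))

-- Last change of a sequence: the largest r ≤ s with f r ≠ f (r - 1) (or 0).  Applied to
-- the flooded minimum, it is the BFS depth of a vertex below the leader.
module LastChange where

  open import Data.Nat
  open import Data.Nat.Properties
  open import Data.Bool using (true; false; if_then_else_)
  open import Data.Sum using (inj₁; inj₂)
  open import Relation.Binary.PropositionalEquality
  open BoolComparisons

  lastChange : (ℕ → ℕ) → ℕ → ℕ
  lastChange f zero = 0
  lastChange f (suc s) = if f (suc s) ≡ᵇ f s then lastChange f s else suc s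

  lastChange-≤ : ∀ f s → lastChange f s ≤ s
  lastChange-≤ f zero = z≤n
  lastChange-≤ f (suc s) with f (suc s) ≡ᵇ f s
  ... | true = m≤n⇒m≤1+n (lastChange-≤ f s)
  ... | false = ≤-refl

  lastChange-const : ∀ f s r → lastChange f s ≤ r → r ≤ s → f r ≡ f s
  lastChange-const f zero zero _ _ = refl
  lastChange-const f (suc s) r p q with f (suc s) ≡ᵇ f s in e
  ... | true with m≤n⇒m<n∨m≡n q
  ...   | inj₁ r<ss = trans (lastChange-const f s r p (≤-pred r<ss)) (sym (≡ᵇ-sound e))
  ...   | inj₂ refl = refl
  lastChange-const f (suc s) r p q | false rewrite ≤-antisym p q = refl

  lastChange-change : ∀ f s → 0 < lastChange f s → f (pred (lastChange f s)) ≢ f (lastChange f s)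
  lastChange-change f (suc s) p with f (suc s) ≡ᵇ f s in e
  ... | true = lastChange-change f s p
  ... | false = λ q → ≡ᵇ-false e (sym q)

  lastChange-cong : ∀ f g s → (∀ r → r ≤ s → f r ≡ g r) → lastChange f s ≡ lastChange g s
  lastChange-cong f g zero h = refl
  lastChange-cong f g (suc s) h rewrite h (suc s) ≤-refl | h s (n≤1+n s)
    | lastChange-cong f g s (λ r p → h r (m≤n⇒m≤1+n p)) = refl

module ListTools where

  open import Data.Nat
  open import Data.Nat.Properties
  open import Data.Bool using (Bool; true; false; if_then_else_)
  open import Data.Empty using (⊥-elim)
  open import Data.Maybe using (Maybe; just; nothing)
  import Data.Maybe as Maybe
  open import Data.List using (List; []; _∷_; map; _++_; replicate; length)
  open import Data.Product using (_×_; _,_; proj₁; proj₂; ∃-syntax)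
  open import Data.Sum using (_⊎_; inj₁; inj₂)
  open import Relation.Binary.PropositionalEquality
  open import Data.List.Membership.Propositional using (_∈_)
  open import Data.List.Relation.Unary.Any using (here; there)
  import Data.List.Relation.Unary.All as All
  open import Data.List.Relation.Unary.AllPairs using ([]; _∷_)
  open import Data.List.Relation.Unary.Unique.Propositional using (Unique)
  open import Function using (_∘_)
  open BoolComparisons

  sumOver : ∀ {A : Set} → (A → ℕ) → List A → ℕ
  sumOver f [] = 0
  sumOver f (x ∷ xs) = f x + sumOver f xs

  sumOver-map : ∀ {A B : Set} (f : B → ℕ) (g : A → B) xs → sumOver f (map g xs) ≡ sumOver (f ∘ g) xs
  sumOver-map f g [] = refl
  sumOver-map f g (x ∷ xs) = cong (f (g x) +_) (sumOver-map f g xs)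

  sumOver-congM : ∀ {A : Set} {f g : A → ℕ} xs → (∀ x → x ∈ xs → f x ≡ g x) → sumOver f xs ≡ sumOver g xs
  sumOver-congM [] h = refl
  sumOver-congM (x ∷ xs) h = cong₂ _+_ (h x (here refl)) (sumOver-congM xs (λ y m → h y (there m)))

  sumOver-zero : ∀ {A : Set} (f : A → ℕ) xs → (∀ x → x ∈ xs → f x ≡ 0) → sumOver f xs ≡ 0
  sumOver-zero f [] h = refl
  sumOver-zero f (x ∷ xs) h rewrite h x (here refl) = sumOver-zero f xs (λ y m → h y (there m))

  select : ∀ {A : Set} → (A → Bool) → List A → List A
  select p [] = []
  select p (x ∷ xs) = if p x then x ∷ select p xs else select p xs

  sumOver-select : ∀ {A : Set} (p : A → Bool) (f : A → ℕ) xs →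
    sumOver f (select p xs) ≡ sumOver (λ x → if p x then f x else 0) xs
  sumOver-select p f [] = refl
  sumOver-select p f (x ∷ xs) with p x
  ... | true = cong (f x +_) (sumOver-select p f xs)
  ... | false = sumOver-select p f xs

  select-∈⁺ : ∀ {A : Set} (p : A → Bool) {x} xs → x ∈ xs → p x ≡ true → x ∈ select p xs
  select-∈⁺ p (y ∷ xs) (here refl) e rewrite e = here refl
  select-∈⁺ p (y ∷ xs) (there m) e with p y
  ... | true = there (select-∈⁺ p xs m e)
  ... | false = select-∈⁺ p xs m e

  select-∈⁻ : ∀ {A : Set} (p : A → Bool) {x} xs → x ∈ select p xs → x ∈ xs × p x ≡ true
  select-∈⁻ p (y ∷ xs) m with p y in e
  select-∈⁻ p (y ∷ xs) (here refl) | true = here refl , e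
  select-∈⁻ p (y ∷ xs) (there m) | true = there (proj₁ (select-∈⁻ p xs m)) , proj₂ (select-∈⁻ p xs m)
  ... | false = there (proj₁ (select-∈⁻ p xs m)) , proj₂ (select-∈⁻ p xs m)

  select-congM : ∀ {A : Set} {p q : A → Bool} xs → (∀ x → x ∈ xs → p x ≡ q x) → select p xs ≡ select q xs
  select-congM [] h = refl
  select-congM {p = p} {q} (x ∷ xs) h rewrite h x (here refl) with q x
  ... | true = cong (x ∷_) (select-congM xs (λ y m → h y (there m)))
  ... | false = select-congM xs (λ y m → h y (there m))

  select-map : ∀ {A B : Set} (p : B → Bool) (g : A → B) xs → select p (map g xs) ≡ map g (select (p ∘ g) xs)
  select-map p g [] = refl
  select-map p g (x ∷ xs) with p (g x)
  ... | true = cong (g x ∷_) (select-map p g xs)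
  ... | false = select-map p g xs

  select-unique : ∀ {A : Set} (p : A → Bool) xs → Unique xs → Unique (select p xs)
  select-unique p [] u = []
  select-unique p (x ∷ xs) (ux ∷ u) with p x
  ... | true = All.tabulate (λ m → All.lookup ux (proj₁ (select-∈⁻ p xs m))) ∷ select-unique p xs u
  ... | false = select-unique p xs u

  firstM : ∀ {A : Set} → (A → Bool) → List A → Maybe A
  firstM p [] = nothing
  firstM p (x ∷ xs) = if p x then just x else firstM p xs

  firstM-map : ∀ {A B : Set} (p : B → Bool) (g : A → B) xs → firstM p (map g xs) ≡ Maybe.map g (firstM (p ∘ g) xs)
  firstM-map p g [] = refl
  firstM-map p g (x ∷ xs) with p (g x)
  ... | true = refl
  ... | false = firstM-map p g xs

  firstM-congM : ∀ {A : Set} {p q : A → Bool} xs → (∀ x → x ∈ xs → p x ≡ q x) → firstM p xs ≡ firstM q xs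
  firstM-congM [] h = refl
  firstM-congM {p = p} {q} (x ∷ xs) h rewrite h x (here refl) with q x
  ... | true = refl
  ... | false = firstM-congM xs (λ y m → h y (there m))

  firstM-sound : ∀ {A : Set} (p : A → Bool) xs {y} → firstM p xs ≡ just y → y ∈ xs × p y ≡ true
  firstM-sound p (x ∷ xs) e with p x in ep
  firstM-sound p (x ∷ xs) refl | true = here refl , ep
  ... | false with firstM-sound p xs e
  ...   | m , q = there m , q

  firstM-complete : ∀ {A : Set} (p : A → Bool) xs {x} → x ∈ xs → p x ≡ true → ∃[ y ] (firstM p xs ≡ just y)
  firstM-complete p (y ∷ xs) m e with p y in ey
  ... | true = y , refl
  firstM-complete p (y ∷ xs) (here refl) e | false with trans (sym ey) e
  ... | ()
  firstM-complete p (y ∷ xs) (there m) e | false = firstM-complete p xs m e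

  minOver : ∀ {A : Set} → (A → ℕ) → List A → ℕ → ℕ
  minOver f [] a = a
  minOver f (x ∷ xs) a = f x ⊓ minOver f xs a

  minOver-≤default : ∀ {A : Set} (f : A → ℕ) xs a → minOver f xs a ≤ a
  minOver-≤default f [] a = ≤-refl
  minOver-≤default f (x ∷ xs) a = m≤n⇒o⊓m≤n (f x) (minOver-≤default f xs a)

  minOver-≤ : ∀ {A : Set} (f : A → ℕ) xs a {x} → x ∈ xs → minOver f xs a ≤ f x
  minOver-≤ f (y ∷ xs) a (here refl) = m⊓n≤m (f y) _
  minOver-≤ f (y ∷ xs) a (there m) = m≤n⇒o⊓m≤n (f y) (minOver-≤ f xs a m)

  minOver-sel : ∀ {A : Set} (f : A → ℕ) xs a → minOver f xs a ≡ a ⊎ ∃[ x ] (x ∈ xs × minOver f xs a ≡ f x)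
  minOver-sel f [] a = inj₁ refl
  minOver-sel f (x ∷ xs) a with ⊓-sel (f x) (minOver f xs a)
  ... | inj₁ e = inj₂ (x , here refl , e)
  ... | inj₂ e with minOver-sel f xs a
  ...   | inj₁ e' = inj₁ (trans e e')
  ...   | inj₂ (y , m , e') = inj₂ (y , there m , trans e e')

  minOver-map : ∀ {A B : Set} (f : B → ℕ) (g : A → B) xs a → minOver f (map g xs) a ≡ minOver (f ∘ g) xs a
  minOver-map f g [] a = refl
  minOver-map f g (x ∷ xs) a = cong (f (g x) ⊓_) (minOver-map f g xs a)

  minOver-congM : ∀ {A : Set} {f g : A → ℕ} xs a → (∀ x → x ∈ xs → f x ≡ g x) → minOver f xs a ≡ minOver g xs a
  minOver-congM [] a h = refl
  minOver-congM (x ∷ xs) a h = cong₂ _⊓_ (h x (here refl)) (minOver-congM xs a (λ y m → h y (there m)))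

  -- the value stored under key i in a list of (key , value) pairs (0 if absent); this
  -- is how a vertex reads the message of a given neighbour out of its inbox
  keyLookup : List (ℕ × ℕ) → ℕ → ℕ
  keyLookup [] i = 0
  keyLookup ((k , m) ∷ xs) i = if k ≡ᵇ i then m else keyLookup xs i

  keyLookup-map : ∀ {A : Set} (key : A → ℕ) (f : A → ℕ) →
    (∀ x y → key x ≡ key y → x ≡ y) →
    ∀ xs {w} → w ∈ xs → keyLookup (map (λ u → key u , f u) xs) (key w) ≡ f w
  keyLookup-map key f inj (y ∷ xs) {w} m with key y ≡ᵇ key w in e
  ... | true = cong f (inj y w (≡ᵇ-sound e))
  keyLookup-map key f inj (y ∷ xs) {w} (here refl) | false = ⊥-elim (≡ᵇ-false {key y} e refl)
  keyLookup-map key f inj (y ∷ xs) {w} (there m) | false = keyLookup-map key f inj xs m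

  -- total index lookup (0 out of range): decoding an ID in the table of classes
  lookupD : List ℕ → ℕ → ℕ
  lookupD [] i = 0
  lookupD (x ∷ xs) zero = x
  lookupD (x ∷ xs) (suc i) = lookupD xs i

  lookupD-++ˡ : ∀ xs ys i → i < length xs → lookupD (xs ++ ys) i ≡ lookupD xs i
  lookupD-++ˡ (x ∷ xs) ys zero p = refl
  lookupD-++ˡ (x ∷ xs) ys (suc i) p = lookupD-++ˡ xs ys i (≤-pred p)

  lookupD-++ʳ : ∀ xs ys r → lookupD (xs ++ ys) (length xs + r) ≡ lookupD ys r
  lookupD-++ʳ [] ys r = refl
  lookupD-++ʳ (x ∷ xs) ys r = lookupD-++ʳ xs ys r

  lookupD-replicate : ∀ k a r → r < k → lookupD (replicate k a) r ≡ a
  lookupD-replicate (suc k) a zero p = refl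
  lookupD-replicate (suc k) a (suc r) p = lookupD-replicate k a r (≤-pred p)

-- Laying out the children of a vertex in list order, child c receives
-- the interval [sumBefore c , sumBefore c + f c) of [0 , sumOver f xs); these intervals
-- are disjoint and cover everything, which is what makes the offsets a bijection.
module PrefixSums where

  open import Data.Nat
  open import Data.Nat.Properties
  open import Data.Bool using (true; false; if_then_else_)
  open import Data.Empty using (⊥-elim)
  open import Data.List using (List; []; _∷_; map)
  open import Data.Product using (_×_; _,_; ∃-syntax)
  open import Data.Sum using (_⊎_; inj₁; inj₂)
  open import Relation.Binary.PropositionalEquality
  open import Data.List.Membership.Propositional using (_∈_)
  open import Data.List.Relation.Unary.Any using (here; there)
  open import Data.List.Relation.Unary.All using (lookup)
  open import Data.List.Relation.Unary.AllPairs using (_∷_)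
  open import Data.List.Relation.Unary.Unique.Propositional using (Unique)
  open import Relation.Nullary using (yes; no)
  open import Function using (_∘_)
  open BoolComparisons
  open ListTools using (sumOver)

  sumBefore : ∀ {A : Set} → (A → ℕ) → (A → ℕ) → List A → A → ℕ
  sumBefore key f [] c = 0
  sumBefore key f (x ∷ xs) c = if key x ≡ᵇ key c then 0 else f x + sumBefore key f xs c

  sumBefore-map : ∀ {A : Set} (g : A → ℕ) (f : ℕ → ℕ) xs c →
    sumBefore (λ i → i) f (map g xs) (g c) ≡ sumBefore g (f ∘ g) xs c
  sumBefore-map g f [] c = refl
  sumBefore-map g f (x ∷ xs) c with g x ≡ᵇ g c
  ... | true = refl
  ... | false = cong (f (g x) +_) (sumBefore-map g f xs c)

  sumBefore-congM : ∀ {A : Set} (key : A → ℕ) {f g : A → ℕ} xs c → (∀ x → x ∈ xs → f x ≡ g x) →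
    sumBefore key f xs c ≡ sumBefore key g xs c
  sumBefore-congM key [] c h = refl
  sumBefore-congM key (x ∷ xs) c h with key x ≡ᵇ key c
  ... | true = refl
  ... | false = cong₂ _+_ (h x (here refl)) (sumBefore-congM key xs c (λ y m → h y (there m)))

  module _ {A : Set} (key : A → ℕ) (inj : ∀ x y → key x ≡ key y → x ≡ y) (f : A → ℕ) where

    sumBefore-∈ : ∀ xs {c} → c ∈ xs → sumBefore key f xs c + f c ≤ sumOver f xs
    sumBefore-∈ (x ∷ xs) {c} m with key x ≡ᵇ key c in e
    ... | true rewrite inj x c (≡ᵇ-sound e) = m≤m+n (f c) (sumOver f xs)
    sumBefore-∈ (x ∷ xs) {c} (here refl) | false = ⊥-elim (≡ᵇ-false {key x} e refl)
    sumBefore-∈ (x ∷ xs) {c} (there m) | false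
      rewrite +-assoc (f x) (sumBefore key f xs c) (f c) = +-monoʳ-≤ (f x) (sumBefore-∈ xs m)

    sumBefore-ord : ∀ xs {a b} → a ∈ xs → b ∈ xs → a ≢ b →
      (sumBefore key f xs a + f a ≤ sumBefore key f xs b) ⊎ (sumBefore key f xs b + f b ≤ sumBefore key f xs a)
    sumBefore-ord (x ∷ xs) {a} {b} ma mb ne with key x ≡ᵇ key a in ea | key x ≡ᵇ key b in eb
    ... | true | true = ⊥-elim (ne (trans (sym (inj x a (≡ᵇ-sound ea))) (inj x b (≡ᵇ-sound eb))))
    ... | true | false rewrite inj x a (≡ᵇ-sound ea) = inj₁ (m≤m+n (f a) _)
    ... | false | true rewrite inj x b (≡ᵇ-sound eb) = inj₂ (m≤m+n (f b) _)
    sumBefore-ord (x ∷ xs) {a} {b} (here refl) mb ne | false | false = ⊥-elim (≡ᵇ-false {key x} ea refl)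
    sumBefore-ord (x ∷ xs) {a} {b} (there ma) (here refl) ne | false | false = ⊥-elim (≡ᵇ-false {key x} eb refl)
    sumBefore-ord (x ∷ xs) {a} {b} (there ma) (there mb) ne | false | false
      rewrite +-assoc (f x) (sumBefore key f xs a) (f a) | +-assoc (f x) (sumBefore key f xs b) (f b)
      with sumBefore-ord xs ma mb ne
    ... | inj₁ p = inj₁ (+-monoʳ-≤ (f x) p)
    ... | inj₂ p = inj₂ (+-monoʳ-≤ (f x) p)

    sumBefore-hd : ∀ x xs → sumBefore key f (x ∷ xs) x ≡ 0
    sumBefore-hd x xs rewrite ≡ᵇ-refl (key x) = refl

    sumBefore-find : ∀ xs → Unique xs → ∀ y → 0 < y → y ≤ sumOver f xs →
      ∃[ c ] (c ∈ xs × sumBefore key f xs c < y × y ≤ sumBefore key f xs c + f c)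
    sumBefore-find [] u y p q = ⊥-elim (<⇒≱ p q)
    sumBefore-find (x ∷ xs) (ux ∷ u) y p q with y ≤? f x
    ... | yes y≤ = x , here refl , subst (λ z → z < y) (sym (sumBefore-hd x xs)) p ,
          subst (λ z → y ≤ z + f x) (sym (sumBefore-hd x xs)) y≤
    ... | no y≰ with sumBefore-find xs u (y ∸ f x) (m<n⇒0<n∸m (≰⇒> y≰))
                        (≤-trans (∸-monoˡ-≤ (f x) q) (≤-reflexive (m+n∸m≡n (f x) _)))
    ...   | c , m , p1 , p2 =
            c , there m ,
            subst (λ z → z < y) (sym bt)
              (≤-trans (≤-reflexive (sym (+-suc (f x) _))) (≤-trans (+-monoʳ-≤ (f x) p1) (≤-reflexive (m+[n∸m]≡n (<⇒≤ (≰⇒> y≰)))))) ,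
            subst (λ z → y ≤ z + f c) (sym bt)
              (≤-trans (≤-reflexive (sym (m+[n∸m]≡n (<⇒≤ (≰⇒> y≰))))) (≤-trans (+-monoʳ-≤ (f x) p2) (≤-reflexive (sym (+-assoc (f x) _ _)))))
      where
      bt : sumBefore key f (x ∷ xs) c ≡ f x + sumBefore key f xs c
      bt rewrite ≡ᵇ-≢ {key x} {key c} (λ k → lookup ux m (inj x c k)) = refl

module Flooding where

  open import Defs
  open LastChange
  open ListTools
  open import Data.Nat
  open import Data.Nat.Properties
  open import Data.Bool using (T; T?)
  open import Data.Empty using (⊥-elim)
  open import Data.Fin using (Fin)
  open import Data.List using (allFin)
  open import Data.List.Properties using (length-tabulate; length-filter)
  open import Data.Product using (_×_; _,_; proj₁; proj₂; ∃-syntax)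
  open import Data.Sum using (inj₁; inj₂)
  open import Relation.Binary.PropositionalEquality
  open import Relation.Binary.Definitions using (tri<; tri≈; tri>)
  open import Data.List.Membership.Propositional using (_∈_)
  open import Relation.Nullary using (¬_)
  open import Data.List.Membership.Propositional.Properties using (∈-filter⁺; ∈-filter⁻; ∈-allFin)

  deg-≤ : ∀ {n} (G : Graph n) v → deg G v ≤ n
  deg-≤ {n} G v = ≤-trans (length-filter (λ x → T? (adj G v x)) (allFin n)) (≤-reflexive (length-tabulate (λ x → x)))

  module WalkFacts {n : ℕ} (G : Graph n) where

    adjT-sym : ∀ {u v} → T (adj G u v) → T (adj G v u)
    adjT-sym {u} {v} a = subst T (adj-sym G u v) a

    nbr⇒adj : ∀ {v w} → w ∈ nbrs G v → T (adj G v w)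
    nbr⇒adj {v} {w} m = proj₂ (∈-filter⁻ (λ x → T? (adj G v x)) {xs = allFin n} m)

    adj⇒nbr : ∀ {v w} → T (adj G v w) → w ∈ nbrs G v
    adj⇒nbr {v} {w} a = ∈-filter⁺ (λ x → T? (adj G v x)) (∈-allFin w) a

    snoc : ∀ {u w v k} → Walk G u w k → T (adj G w v) → Walk G u v (suc k)
    snoc here a = step a here
    snoc (step a' p) a = step a' (snoc p a)

    unsnoc : ∀ {u v k} → Walk G u v (suc k) → ∃[ w ] (Walk G u w k × T (adj G w v))
    unsnoc (step a here) = _ , here , a
    unsnoc (step a (step a' p)) with unsnoc (step a' p)
    ... | w , q , b = w , step a q , b

    dist-mono : ∀ {u v d d'} → Dist≤ G u v d → d ≤ d' → Dist≤ G u v d'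
    dist-mono (k , k≤d , p) q = k , ≤-trans k≤d q , p

    dist0 : ∀ {u v} → Dist≤ G u v 0 → u ≡ v
    dist0 (zero , _ , here) = refl

    dist-snoc : ∀ {u w v d} → Dist≤ G u w d → T (adj G w v) → Dist≤ G u v (suc d)
    dist-snoc (k , k≤d , p) a = suc k , s≤s k≤d , snoc p a

    dist-refl : ∀ {u} d → Dist≤ G u u d
    dist-refl d = 0 , z≤n , here

  module MinFlood {n : ℕ} (G : Graph n) (ids : Fin n → ℕ) where
    open WalkFacts G

    floodMin : ℕ → Fin n → ℕ
    floodMin zero v = ids v
    floodMin (suc s) v = minOver (floodMin s) (nbrs G v) (floodMin s v)

    floodMin-mono : ∀ {r s} v → r ≤ s → floodMin s v ≤ floodMin r v
    floodMin-mono {r} {s} v p with m≤n⇒m<n∨m≡n p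
    ... | inj₂ refl = ≤-refl
    floodMin-mono {r} {suc s} v p | inj₁ (s≤s q) =
      ≤-trans (minOver-≤default (floodMin s) (nbrs G v) (floodMin s v)) (floodMin-mono v q)

    floodMin-wit : ∀ s v → ∃[ u ] (floodMin s v ≡ ids u × Dist≤ G u v s)
    floodMin-wit zero v = v , refl , dist-refl 0
    floodMin-wit (suc s) v with minOver-sel (floodMin s) (nbrs G v) (floodMin s v)
    ... | inj₁ e with floodMin-wit s v
    ...   | u , e' , d = u , trans e e' , dist-mono d (n≤1+n s)
    floodMin-wit (suc s) v | inj₂ (w , m , e) with floodMin-wit s w
    ...   | u , e' , d = u , trans e e' , dist-snoc d (adjT-sym (nbr⇒adj m))

    floodMin-dist : ∀ s u v → Dist≤ G u v s → floodMin s v ≤ ids u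
    floodMin-dist s u v (zero , _ , here) = floodMin-mono {0} {s} v z≤n
    floodMin-dist (suc s) u v (suc k , s≤s k≤s , p) with unsnoc p
    ... | w , q , a = ≤-trans (minOver-≤ (floodMin s) (nbrs G v) (floodMin s v) (adj⇒nbr (adjT-sym a)))
                               (floodMin-dist s u w (k , k≤s , q))

  -- Flooding from the vertex L of minimum identifier in a graph of diameter D: v holds
  -- ids L exactly from round dist(L,v) on, so the last change of its value within
  -- G ≥ D rounds is its distance from L.
  module FloodFromMin {n : ℕ} (Gr : Graph n) (ids : Fin n → ℕ) (inj : ∀ x y → ids x ≡ ids y → x ≡ y)
    (D : ℕ) (diam : IsDiameter Gr D) (L : Fin n) (Lmin : ∀ u → ids L ≤ ids u) where
    open MinFlood Gr ids
    open WalkFacts Gr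

    reached⇒leader : ∀ s v → Dist≤ Gr L v s → floodMin s v ≡ ids L
    reached⇒leader s v d with floodMin-wit s v
    ... | u , e , _ = ≤-antisym (floodMin-dist s L v d) (subst (ids L ≤_) (sym e) (Lmin u))

    leader⇒reached : ∀ s v → floodMin s v ≡ ids L → Dist≤ Gr L v s
    leader⇒reached s v e with floodMin-wit s v
    ... | u , e' , d = subst (λ z → Dist≤ Gr z v s) (inj u L (trans (sym e') e)) d

    leader-settled : ∀ G → D ≤ G → ∀ v → floodMin G v ≡ ids L
    leader-settled G p v = reached⇒leader G v (dist-mono (proj₁ diam L v) p)

    IsDistance : Fin n → ℕ → Set
    IsDistance v d = Dist≤ Gr L v d × (∀ r → r < d → ¬ Dist≤ Gr L v r)

    isDistance-unique : ∀ {v d1 d2} → IsDistance v d1 → IsDistance v d2 → d1 ≡ d2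
    isDistance-unique {v} {d1} {d2} (a1 , b1) (a2 , b2) with <-cmp d1 d2
    ... | tri< x _ _ = ⊥-elim (b2 d1 x a1)
    ... | tri≈ _ x _ = x
    ... | tri> _ _ x = ⊥-elim (b1 d2 x a2)

    lastChange-distance : ∀ G → D ≤ G → ∀ v → IsDistance v (lastChange (λ s → floodMin s v) G)
    lastChange-distance G p v = reached , minimal
      where
      d = lastChange (λ s → floodMin s v) G
      reached : Dist≤ Gr L v d
      reached = leader⇒reached d v (trans (lastChange-const (λ s → floodMin s v) G d ≤-refl (lastChange-≤ _ G))
                                          (leader-settled G p v))
      minimal : ∀ r → r < d → ¬ Dist≤ Gr L v r
      minimal r q dr = lastChange-change (λ s → floodMin s v) G (≤-trans (s≤s z≤n) q)
        (trans (reached⇒leader (pred d) v (dist-mono dr (pred-mono-≤ q))) (sym (reached⇒leader d v reached)))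

    isDistance-L : IsDistance L 0
    isDistance-L = dist-refl 0 , λ r ()

    isDistance-0 : ∀ {v} → IsDistance v 0 → v ≡ L
    isDistance-0 (a , _) = sym (dist0 a)

    isDistance-pred : ∀ {v d} → IsDistance v (suc d) → ∃[ w ] (T (adj Gr w v) × IsDistance w d)
    isDistance-pred {v} {d} (a , b) with a
    ... | k , k≤ , p with m≤n⇒m<n∨m≡n k≤
    ...   | inj₁ k< = ⊥-elim (b k k< (k , ≤-refl , p))
    ...   | inj₂ refl with unsnoc p
    ...     | w , q , adjw = w , adjw , (d , ≤-refl , q) , λ r r< dr → b (suc r) (s≤s r<) (dist-snoc dr adjw)

-- The subtree of w then occupies [off j w , off j w + cnt j w) (interval), and the offsets
-- of its class-j vertices are exactly that interval without repetition (inject, surject).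
-- In a single tree with root ρ, placing the classes one after the other gives the
-- ranking ID v = 1 + (sizes of classes below cls v) + off (cls v) v, a bijection onto
-- 1..n that is sorted by class (module Ranking).
module TreeNumbering where

  open BoolComparisons
  open ListTools
  open PrefixSums
  open import Data.Nat
  open import Data.Nat.Properties
  open import Data.Bool using (Bool; true; false; if_then_else_)
  open import Data.Empty using (⊥; ⊥-elim)
  open import Data.Fin using (Fin; toℕ; fromℕ<) renaming (_≟_ to _≟F_)
  open import Data.Fin.Properties using (toℕ-fromℕ<; toℕ<n; toℕ-injective; injective⇒≤)
  open import Data.Maybe using (Maybe; just; nothing)
  open import Data.List using (List; []; _++_; replicate; length)
  open import Data.List.Properties using (length-++; length-replicate)
  open import Data.Product using (_×_; _,_; proj₁; proj₂; ∃-syntax)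
  open import Data.Sum using (_⊎_; inj₁; inj₂)
  open import Relation.Binary.PropositionalEquality
  open import Data.List.Membership.Propositional using (_∈_)
  open import Data.List.Relation.Unary.Unique.Propositional using (Unique)
  open import Relation.Nullary using (yes; no)
  open import Relation.Binary.Definitions using (tri<; tri≈; tri>)

  -- "the parent pointer m points to w", compared through identifiers as a vertex does
  isPar : ∀ {n} → (Fin n → ℕ) → Maybe (Fin n) → Fin n → Bool
  isPar ids nothing w = false
  isPar ids (just x) w = ids x ≡ᵇ ids w

  bindM : ∀ {n} → Maybe (Fin n) → (Fin n → Maybe (Fin n)) → Maybe (Fin n)
  bindM nothing f = nothing
  bindM (just x) f = f x

  bind-just : ∀ {n} {m : Maybe (Fin n)} → bindM m just ≡ m
  bind-just {m = nothing} = refl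
  bind-just {m = just x} = refl

  module Forest {n : ℕ} (ids : Fin n → ℕ) (inj : ∀ x y → ids x ≡ ids y → x ≡ y)
    (nb : Fin n → List (Fin n)) (nb-uniq : ∀ w → Unique (nb w))
    (par : Fin n → Maybe (Fin n)) (dep : Fin n → ℕ) (Gd : ℕ) (cls : Fin n → ℕ)
    (par-dep : ∀ c w → par c ≡ just w → suc (dep w) ≡ dep c)
    (par-nb : ∀ c w → par c ≡ just w → c ∈ nb w)
    (dep-≤ : ∀ v → dep v ≤ Gd) where

    ch : Fin n → List (Fin n)
    ch w = select (λ c → isPar ids (par c) w) (nb w)

    isPar-just : ∀ {m w} → isPar ids m w ≡ true → m ≡ just w
    isPar-just {just x} {w} e = cong just (inj x w (≡ᵇ-sound e))

    ch⇒par : ∀ {w c} → c ∈ ch w → par c ≡ just w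
    ch⇒par {w} {c} m = isPar-just (proj₂ (select-∈⁻ _ (nb w) m))

    par⇒ch : ∀ {w c} → par c ≡ just w → c ∈ ch w
    par⇒ch {w} {c} e = select-∈⁺ _ (nb w) (par-nb c w e) (subst (λ m → isPar ids m w ≡ true) (sym e) (≡ᵇ-refl (ids w)))

    ch-dep : ∀ {w c} → c ∈ ch w → dep c ≡ suc (dep w)
    ch-dep m = sym (par-dep _ _ (ch⇒par m))

    ch-nodeep : ∀ {w c} → Gd ≤ dep w → c ∈ ch w → ⊥
    ch-nodeep {w} {c} p m = <⇒≱ (≤-trans (s≤s p) (≤-reflexive (sym (ch-dep m)))) (dep-≤ c)

    -- inductions over subtrees are on a height budget h with Gd ≤ dep w + h; moving
    -- to a child uses up one unit
    dep-step : ∀ {w c h} → par c ≡ just w → Gd ≤ dep w + suc h → Gd ≤ dep c + h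
    dep-step {w} {c} {h} e p = ≤-trans p (≤-reflexive (trans (+-suc (dep w) h) (cong (_+ h) (par-dep c w e))))

    no-budget : ∀ {w c} → Gd ≤ dep w + 0 → par c ≡ just w → ⊥
    no-budget p e = ch-nodeep (≤-trans p (≤-reflexive (+-identityʳ _))) (par⇒ch e)

    own : ℕ → Fin n → ℕ
    own j v = if cls v ≡ᵇ j then 1 else 0

    own-1 : ∀ {j v} → cls v ≡ j → own j v ≡ 1
    own-1 {j} {v} refl rewrite ≡ᵇ-refl (cls v) = refl

    own-0 : ∀ {j v} → cls v ≢ j → own j v ≡ 0
    own-0 {j} {v} ne rewrite ≡ᵇ-≢ ne = refl

    cntF : ℕ → ℕ → Fin n → ℕ
    cntF zero j v = own j v
    cntF (suc h) j v = own j v + sumOver (cntF h j) (ch v)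

    cnt : ℕ → Fin n → ℕ
    cnt j v = cntF (Gd ∸ dep v) j v

    cnt-rec : ∀ j w → cnt j w ≡ own j w + sumOver (cnt j) (ch w)
    cnt-rec j w with Gd ∸ dep w in e
    ... | zero = sym (trans (cong (own j w +_) (sumOver-zero (cnt j) (ch w)
                    (λ c m → ⊥-elim (ch-nodeep (m∸n≡0⇒m≤n e) m)))) (+-identityʳ _))
    ... | suc h = cong (own j w +_) (sumOver-congM (ch w) (λ c m → cong (λ z → cntF z j c) (sym (child-height c m))))
      where
      child-height : ∀ c → c ∈ ch w → Gd ∸ dep c ≡ h
      child-height c m rewrite ch-dep m = trans (sym (pred[m∸n]≡m∸[1+n] Gd (dep w))) (cong pred e)

    offStep : (ℕ → Fin n → ℕ) → ℕ → Fin n → Maybe (Fin n) → ℕ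
    offStep o j v nothing = 0
    offStep o j v (just w) = o j w + own j w + sumBefore ids (cnt j) (ch w) v

    offF : ℕ → ℕ → Fin n → ℕ
    offF zero j v = 0
    offF (suc d) j v = offStep (offF d) j v (par v)

    off : ℕ → Fin n → ℕ
    off j v = offF (dep v) j v

    off-rec : ∀ {j v w} → par v ≡ just w → off j v ≡ off j w + own j w + sumBefore ids (cnt j) (ch w) v
    off-rec {j} {v} {w} e rewrite sym (par-dep v w e) | e = refl

    off-root : ∀ {j v} → par v ≡ nothing → off j v ≡ 0
    off-root {j} {v} e with dep v
    ... | zero = refl
    ... | suc d rewrite e = refl

    anc : ℕ → Fin n → Maybe (Fin n)
    anc zero u = just u
    anc (suc k) u = bindM (anc k u) par

    anc-suc : ∀ k u {w} → anc (suc k) u ≡ just w → ∃[ c ] (anc k u ≡ just c × par c ≡ just w)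
    anc-suc k u e with anc k u
    ... | just c = c , refl , e

    nest : ∀ j {c w} → par c ≡ just w →
      (off j w + own j w ≤ off j c) × (off j c + cnt j c ≤ off j w + cnt j w)
    nest j {c} {w} e rewrite off-rec {j} e =
      m≤m+n _ _ ,
      ≤-trans (≤-reflexive (+-assoc (off j w + own j w) _ _))
        (≤-trans (+-monoʳ-≤ (off j w + own j w) (sumBefore-∈ ids inj (cnt j) (ch w) (par⇒ch e)))
          (≤-reflexive (trans (+-assoc (off j w) _ _) (cong (off j w +_) (sym (cnt-rec j w))))))

    siblings-ordered : ∀ j {w b1 b2} → par b1 ≡ just w → par b2 ≡ just w →
      sumBefore ids (cnt j) (ch w) b1 + cnt j b1 ≤ sumBefore ids (cnt j) (ch w) b2 →
      off j b1 + cnt j b1 ≤ off j b2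
    siblings-ordered j {w} {b1} {b2} e1 e2 o = begin
      off j b1 + cnt j b1                                          ≡⟨ cong (_+ cnt j b1) (off-rec e1) ⟩
      off j w + own j w + sumBefore ids (cnt j) (ch w) b1 + cnt j b1 ≡⟨ +-assoc (off j w + own j w) _ _ ⟩
      off j w + own j w + (sumBefore ids (cnt j) (ch w) b1 + cnt j b1) ≤⟨ +-monoʳ-≤ (off j w + own j w) o ⟩
      off j w + own j w + sumBefore ids (cnt j) (ch w) b2            ≡⟨ sym (off-rec e2) ⟩
      off j b2                                                     ∎
      where open ≤-Reasoning

    interval : ∀ j h w → Gd ≤ dep w + h → ∀ k u → anc k u ≡ just w → cls u ≡ j →
      (off j w ≤ off j u) × (off j u < off j w + cnt j w)
    interval j h w p zero u refl cu rewrite cnt-rec j w | own-1 cu =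
      ≤-refl , ≤-trans (≤-reflexive (+-comm 1 (off j u))) (+-monoʳ-≤ (off j u) (m≤m+n 1 _))
    interval j h w p (suc k) u e cu with anc-suc k u e
    interval j zero w p (suc k) u e cu | c , e1 , e2 = ⊥-elim (no-budget p e2)
    interval j (suc h) w p (suc k) u e cu | c , e1 , e2 with interval j h c (dep-step e2 p) k u e1 cu | nest j e2
    ... | q1 , q2 | r1 , r2 = ≤-trans (≤-trans (m≤m+n _ _) r1) q1 , ≤-trans q2 r2

    interval-proper : ∀ j h w → Gd ≤ dep w + h → ∀ k u → anc (suc k) u ≡ just w → cls u ≡ j →
      off j w + own j w ≤ off j u
    interval-proper j h w p k u e cu with anc-suc k u e
    interval-proper j zero w p k u e cu | c , e1 , e2 = ⊥-elim (no-budget p e2)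
    interval-proper j (suc h) w p k u e cu | c , e1 , e2 =
      ≤-trans (proj₁ (nest j e2)) (proj₁ (interval j h c (dep-step e2 p) k u e1 cu))

    proper-after : ∀ j h u → Gd ≤ dep u + h → ∀ k x → anc (suc k) x ≡ just u → cls u ≡ j → cls x ≡ j →
      off j u < off j x
    proper-after j h u p k x e cu cx =
      ≤-trans (≤-reflexive (+-comm 1 (off j u)))
        (subst (λ z → off j u + z ≤ off j x) (own-1 cu) (interval-proper j h u p k x e cx))

    sibling-descendants : ∀ j h {w b1 b2} → Gd ≤ dep w + suc h → par b1 ≡ just w → par b2 ≡ just w →
      sumBefore ids (cnt j) (ch w) b1 + cnt j b1 ≤ sumBefore ids (cnt j) (ch w) b2 →
      ∀ l1 x1 l2 x2 → anc l1 x1 ≡ just b1 → anc l2 x2 ≡ just b2 → cls x1 ≡ j → cls x2 ≡ j →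
      off j x1 < off j x2
    sibling-descendants j h p q1 q2 o l1 x1 l2 x2 r1 r2 d1 d2 =
      ≤-trans (proj₂ (interval j h _ (dep-step q1 p) l1 _ r1 d1))
        (≤-trans (siblings-ordered j q1 q2 o) (proj₁ (interval j h _ (dep-step q2 p) l2 _ r2 d2)))

    inject : ∀ j h w → Gd ≤ dep w + h → ∀ k1 u1 k2 u2 → anc k1 u1 ≡ just w → anc k2 u2 ≡ just w →
      cls u1 ≡ j → cls u2 ≡ j → off j u1 ≡ off j u2 → u1 ≡ u2
    inject j h w p zero u1 zero u2 refl refl c1 c2 eq = refl
    inject j h w p zero u1 (suc k2) u2 refl e2 c1 c2 eq = ⊥-elim (<⇒≢ (proper-after j h u1 p k2 u2 e2 c1 c2) eq)
    inject j h w p (suc k1) u1 zero u2 e1 refl c1 c2 eq = ⊥-elim (<⇒≢ (proper-after j h u2 p k1 u1 e1 c2 c1) (sym eq))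
    inject j h w p (suc k1) u1 (suc k2) u2 e1 e2 c1 c2 eq with anc-suc k1 u1 e1 | anc-suc k2 u2 e2
    inject j zero w p (suc k1) u1 (suc k2) u2 e1 e2 c1 c2 eq | a1 , f1 , g1 | _ = ⊥-elim (no-budget p g1)
    inject j (suc h) w p (suc k1) u1 (suc k2) u2 e1 e2 c1 c2 eq | a1 , f1 , g1 | a2 , f2 , g2 with a1 ≟F a2
    ... | yes refl = inject j h a1 (dep-step g1 p) k1 u1 k2 u2 f1 f2 c1 c2 eq
    ... | no ne with sumBefore-ord ids inj (cnt j) (ch w) (par⇒ch g1) (par⇒ch g2) ne
    ...   | inj₁ o = ⊥-elim (<⇒≢ (sibling-descendants j h p g1 g2 o k1 u1 k2 u2 f1 f2 c1 c2) eq)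
    ...   | inj₂ o = ⊥-elim (<⇒≢ (sibling-descendants j h p g2 g1 o k2 u2 k1 u1 f2 f1 c2 c1) (sym eq))

    anc-shift : ∀ k v → anc (suc k) v ≡ bindM (par v) (anc k)
    anc-shift zero v = sym bind-just
    anc-shift (suc k) v rewrite anc-shift k v with par v
    ... | nothing = refl
    ... | just w = refl

    anc-step : ∀ k u {c w} → anc k u ≡ just c → par c ≡ just w → anc (suc k) u ≡ just w
    anc-step k u e1 e2 rewrite e1 = e2

    self-or-after : ∀ j w x → off j w ≤ x → (cls w ≡ j × x ≡ off j w) ⊎ (off j w + own j w ≤ x)
    self-or-after j w x p with cls w ≟ j
    ... | no cw = inj₂ (subst (λ z → off j w + z ≤ x) (sym (own-0 cw)) (≤-trans (≤-reflexive (+-identityʳ _)) p))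
    ... | yes cw with x ≟ off j w
    ...   | yes x≡ = inj₁ (cw , x≡)
    ...   | no x≢ = inj₂ (subst (λ z → off j w + z ≤ x) (sym (own-1 cw))
                            (≤-trans (≤-reflexive (+-comm (off j w) 1)) (≤∧≢⇒< p (λ e → x≢ (sym e)))))

    child-covering : ∀ j w x → off j w + own j w ≤ x → x < off j w + cnt j w →
      ∃[ c ] (par c ≡ just w × off j c ≤ x × x < off j c + cnt j c)
    child-covering j w x a≤x x< = from-child
      (sumBefore-find ids inj (cnt j) (ch w) (select-unique _ (nb w) (nb-uniq w)) (suc y) (s≤s z≤n) y<sum)
      where
      open ≤-Reasoning
      a = off j w + own j w
      y = x ∸ a
      x≡ : a + y ≡ x
      x≡ = m+[n∸m]≡n a≤x
      y<sum : suc y ≤ sumOver (cnt j) (ch w)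
      y<sum = +-cancelˡ-≤ a _ _ (begin
        a + suc y                        ≡⟨ +-suc a y ⟩
        suc (a + y)                      ≡⟨ cong suc x≡ ⟩
        suc x                            ≤⟨ x< ⟩
        off j w + cnt j w                ≡⟨ cong (off j w +_) (cnt-rec j w) ⟩
        off j w + (own j w + sumOver (cnt j) (ch w)) ≡⟨ sym (+-assoc (off j w) _ _) ⟩
        a + sumOver (cnt j) (ch w)       ∎)
      from-child : ∃[ c ] (c ∈ ch w × sumBefore ids (cnt j) (ch w) c < suc y ×
                           suc y ≤ sumBefore ids (cnt j) (ch w) c + cnt j c) →
                   ∃[ c ] (par c ≡ just w × off j c ≤ x × x < off j c + cnt j c)
      from-child (c , m , b1 , b2) = c , e , lower , upper
        where
        e = ch⇒par m
        lower : off j c ≤ x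
        lower = begin
          off j c                              ≡⟨ off-rec e ⟩
          a + sumBefore ids (cnt j) (ch w) c   ≤⟨ +-monoʳ-≤ a (≤-pred b1) ⟩
          a + y                                ≡⟨ x≡ ⟩
          x                                    ∎
        upper : x < off j c + cnt j c
        upper = begin-strict
          x                                    ≡⟨ sym x≡ ⟩
          a + y                                <⟨ +-monoʳ-< a (n<1+n y) ⟩
          a + suc y                            ≤⟨ +-monoʳ-≤ a b2 ⟩
          a + (sumBefore ids (cnt j) (ch w) c + cnt j c) ≡⟨ sym (+-assoc a _ _) ⟩
          a + sumBefore ids (cnt j) (ch w) c + cnt j c   ≡⟨ cong (_+ cnt j c) (sym (off-rec e)) ⟩
          off j c + cnt j c                    ∎

    surject : ∀ j h w → Gd ≤ dep w + h → ∀ x → off j w ≤ x → x < off j w + cnt j w →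
      ∃[ k ] ∃[ u ] (anc k u ≡ just w × cls u ≡ j × off j u ≡ x)
    surject j h w p x p1 p2 with self-or-after j w x p1
    ... | inj₁ (cw , refl) = 0 , w , refl , cw , refl
    ... | inj₂ after with child-covering j w x after p2 | h
    ...   | c , e , q1 , q2 | zero = ⊥-elim (no-budget p e)
    ...   | c , e , q1 , q2 | suc h' with surject j h' c (dep-step e p) x q1 q2
    ...     | k , u , r1 , r2 , r3 = suc k , u , anc-step k u r1 e , r2 , r3

    -- hence the class-j vertices below w inject into the vertex set
    cnt-≤n : ∀ j w → cnt j w ≤ n
    cnt-≤n j w = injective⇒≤ {f = vertexAt} (λ {i} {i'} e → toℕ-injective
                   (+-cancelˡ-≡ (off j w) _ _ (trans (sym (vertexAt-off i)) (trans (cong (off j) e) (vertexAt-off i')))))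
      where
      found : (i : Fin (cnt j w)) → ∃[ k ] ∃[ u ] (anc k u ≡ just w × cls u ≡ j × off j u ≡ off j w + toℕ i)
      found i = surject j Gd w (m≤n+m Gd (dep w)) (off j w + toℕ i) (m≤m+n _ _) (+-monoʳ-< (off j w) (toℕ<n i))
      vertexAt : Fin (cnt j w) → Fin n
      vertexAt i = proj₁ (proj₂ (found i))
      vertexAt-off : ∀ i → off j (vertexAt i) ≡ off j w + toℕ i
      vertexAt-off i = proj₂ (proj₂ (proj₂ (proj₂ (found i))))

    cnt-zero : ∀ j → (∀ u → cls u ≢ j) → ∀ h w → Gd ≤ dep w + h → cnt j w ≡ 0
    cnt-zero j nc zero w p rewrite cnt-rec j w | own-0 {j} {w} (nc w) =
      sumOver-zero (cnt j) (ch w) λ c m → ⊥-elim (no-budget p (ch⇒par m))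
    cnt-zero j nc (suc h) w p rewrite cnt-rec j w | own-0 {j} {w} (nc w) =
      sumOver-zero (cnt j) (ch w) λ c m → cnt-zero j nc h c (dep-step (ch⇒par m) p)

    -- the count of the root of v's tree, by recursion along the parent pointers; this is
    -- what the broadcast stage delivers to every vertex
    rootCntStep : (ℕ → Fin n → ℕ) → ℕ → Fin n → Maybe (Fin n) → ℕ
    rootCntStep o j v nothing = cnt j v
    rootCntStep o j v (just w) = o j w

    rootCntF : ℕ → ℕ → Fin n → ℕ
    rootCntF zero j v = cnt j v
    rootCntF (suc d) j v = rootCntStep (rootCntF d) j v (par v)

    rootCnt : ℕ → Fin n → ℕ
    rootCnt j v = rootCntF (dep v) j v

    rootCnt-rec : ∀ {j v w} → par v ≡ just w → rootCnt j v ≡ rootCnt j w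
    rootCnt-rec {j} {v} {w} e rewrite sym (par-dep v w e) | e = refl

    rootCnt-root : ∀ {j v} → par v ≡ nothing → rootCnt j v ≡ cnt j v
    rootCnt-root {j} {v} e = go (dep v)
      where
      go : ∀ d → rootCntF d j v ≡ cnt j v
      go zero = refl
      go (suc d) rewrite e = refl

    dep0-root : ∀ {v} → dep v ≡ 0 → par v ≡ nothing
    dep0-root {v} e with par v in pe
    ... | nothing = refl
    ... | just w with trans (par-dep v w pe) e
    ...   | ()

    rootCnt-bound-d : ∀ j d v → dep v ≡ d → (off j v + cnt j v ≤ rootCnt j v) × (rootCnt j v ≤ n)
    rootCnt-bound-d j zero v e rewrite rootCnt-root {j} {v} (dep0-root e) | off-root {j} {v} (dep0-root e) = ≤-refl , cnt-≤n j v
    rootCnt-bound-d j (suc d) v e with par v in pe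
    ... | nothing rewrite rootCnt-root {j} {v} pe | off-root {j} {v} pe = ≤-refl , cnt-≤n j v
    ... | just w with rootCnt-bound-d j d w (suc-injective (trans (par-dep v w pe) e))
    ...   | b1 , b2 rewrite rootCnt-rec {j} pe = ≤-trans (proj₂ (nest j pe)) b1 , b2

    rootCnt-bound : ∀ j v → (off j v + cnt j v ≤ rootCnt j v) × (rootCnt j v ≤ n)
    rootCnt-bound j v = rootCnt-bound-d j (dep v) v refl

    module Ranking (ρ : Fin n) (ρ-root : par ρ ≡ nothing) (reach : ∀ v → ∃[ k ] (anc k v ≡ just ρ))
                   (K : ℕ) (cls-≤ : ∀ v → cls v ≤ K) where

      classSize : ℕ → ℕ
      classSize j = cnt j ρ

      B : ℕ → ℕ
      B zero = 0
      B (suc j) = B j + classSize j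

      ID : Fin n → ℕ
      ID v = suc (B (cls v) + off (cls v) v)

      B-mono : ∀ {i j} → i ≤ j → B i ≤ B j
      B-mono {i} {j} p with m≤n⇒m<n∨m≡n p
      ... | inj₂ refl = ≤-refl
      B-mono {i} {suc j} p | inj₁ (s≤s q) = ≤-trans (B-mono q) (m≤m+n (B j) _)

      off-lt : ∀ v → off (cls v) v < classSize (cls v)
      off-lt v with reach v
      ... | k , e = subst (λ z → off (cls v) v < z + cnt (cls v) ρ) (off-root {cls v} ρ-root)
                      (proj₂ (interval (cls v) Gd ρ (m≤n+m Gd (dep ρ)) k v e refl))

      ID-in-block : ∀ v → B (cls v) < ID v × ID v ≤ B (suc (cls v))
      ID-in-block v = s≤s (m≤m+n _ _) , ≤-trans (≤-reflexive (sym (+-suc _ _))) (+-monoʳ-≤ (B (cls v)) (off-lt v))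

      cls-lt : ∀ u v → cls u < cls v → ID u < ID v
      cls-lt u v p = ≤-<-trans (proj₂ (ID-in-block u)) (≤-<-trans (B-mono p) (proj₁ (ID-in-block v)))

      ID-mono : ∀ u v → ID u < ID v → cls u ≤ cls v
      ID-mono u v p with cls u ≤? cls v
      ... | yes q = q
      ... | no q = ⊥-elim (<-asym p (cls-lt v u (≰⇒> q)))

      ID-inj : ∀ u v → ID u ≡ ID v → u ≡ v
      ID-inj u v e with <-cmp (cls u) (cls v)
      ... | tri< a _ _ = ⊥-elim (<-irrefl e (cls-lt u v a))
      ... | tri> _ _ c = ⊥-elim (<-irrefl (sym e) (cls-lt v u c))
      ... | tri≈ _ b _ with reach u | reach v
      ...   | k1 , e1 | k2 , e2 = inject (cls u) Gd ρ (m≤n+m Gd (dep ρ)) k1 u k2 v e1 e2 refl (sym b)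
              (+-cancelˡ-≡ (B (cls u)) _ _ (trans (suc-injective e) (cong (λ z → B z + off z v) (sym b))))

      Tot : ℕ
      Tot = B (suc K)

      ID-≤Tot : ∀ v → ID v ≤ Tot
      ID-≤Tot v = ≤-trans (proj₂ (ID-in-block v)) (B-mono (s≤s (cls-≤ v)))

      findB : ∀ m x → 0 < x → x ≤ B m → ∃[ j ] (j < m × B j < x × x ≤ B (suc j))
      findB zero x p q = ⊥-elim (<⇒≱ p q)
      findB (suc m) x p q with x ≤? B m
      ... | yes r with findB m x p r
      ...   | j , a , b , c = j , m≤n⇒m≤1+n a , b , c
      findB (suc m) x p q | no r = m , ≤-refl , ≰⇒> r , q

      ID-surj : ∀ x → 0 < x → x ≤ Tot → ∃[ v ] (ID v ≡ x)
      ID-surj x p q with findB (suc K) x p q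
      ... | j , _ , b , c with surject j Gd ρ (m≤n+m Gd (dep ρ)) (x ∸ suc (B j)) lo hi
        where
        lo : off j ρ ≤ x ∸ suc (B j)
        lo = subst (_≤ x ∸ suc (B j)) (sym (off-root {j} ρ-root)) z≤n
        hi : x ∸ suc (B j) < off j ρ + cnt j ρ
        hi rewrite off-root {j} ρ-root = +-cancelˡ-< (suc (B j)) _ _
               (s≤s (≤-trans (≤-reflexive (m+[n∸m]≡n b)) c))
      ...   | k , u , e1 , e2 , e3 = u , (begin
            suc (B (cls u) + off (cls u) u) ≡⟨ cong (λ z → suc (B z + off z u)) e2 ⟩
            suc (B j + off j u)             ≡⟨ cong (λ z → suc (B j + z)) e3 ⟩
            suc (B j + (x ∸ suc (B j)))     ≡⟨ sym (+-suc (B j) _) ⟩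
            B j + suc (x ∸ suc (B j))       ≡⟨ cong (B j +_) (sym (+-∸-assoc 1 b)) ⟩
            B j + (suc x ∸ suc (B j))       ≡⟨ m+[n∸m]≡n (≤-trans (n≤1+n (B j)) b) ⟩
            x                               ∎)
        where open ≡-Reasoning

      -- ID is a bijection onto 1..Tot, so Tot = n
      Tot-≡ : Tot ≡ n
      Tot-≡ = ≤-antisym Tot≤n n≤Tot
        where
        n≤Tot : n ≤ Tot
        n≤Tot = injective⇒≤ {f = λ v → fromℕ< {pred (ID v)} (ID-≤Tot v)} (λ {a} {b} e → ID-inj a b (cong suc
                 (trans (sym (toℕ-fromℕ< (ID-≤Tot a))) (trans (cong toℕ e) (toℕ-fromℕ< (ID-≤Tot b))))))
        preimage : ∀ (i : Fin Tot) → ∃[ v ] (ID v ≡ suc (toℕ i))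
        preimage i = ID-surj (suc (toℕ i)) (s≤s z≤n) (toℕ<n i)
        Tot≤n : Tot ≤ n
        Tot≤n = injective⇒≤ {f = λ i → proj₁ (preimage i)} (λ {a} {b} e → toℕ-injective (suc-injective
                (trans (sym (proj₂ (preimage a))) (trans (cong ID e) (proj₂ (preimage b))))))

      -- the stored information: the list whose (ID - 1)-th entry is the class of ID
      blk : ℕ → List ℕ
      blk zero = []
      blk (suc j) = blk j ++ replicate (classSize j) j

      blk-len : ∀ j → length (blk j) ≡ B j
      blk-len zero = refl
      blk-len (suc j) = trans (length-++ (blk j)) (cong₂ _+_ (blk-len j) (length-replicate (classSize j)))

      blk-look : ∀ m j r → j < m → r < classSize j → lookupD (blk m) (B j + r) ≡ j
      blk-look (suc m) j r p q with m≤n⇒m<n∨m≡n (≤-pred p)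
      ... | inj₁ j<m = trans (lookupD-++ˡ (blk m) _ _ (≤-trans (+-monoʳ-< (B j) q) (≤-trans (B-mono j<m) (≤-reflexive (sym (blk-len m))))))
                             (blk-look m j r j<m q)
      ... | inj₂ refl = trans (cong (lookupD (blk (suc j))) (cong (_+ r) (sym (blk-len j))))
                         (trans (lookupD-++ʳ (blk j) _ r) (lookupD-replicate (classSize j) j r q))

      info : List ℕ
      info = blk (suc K)

      decode-ok : ∀ v → lookupD info (pred (ID v)) ≡ cls v
      decode-ok v = blk-look (suc K) (cls v) (off (cls v) v) (s≤s (cls-≤ v)) (off-lt v)

-- A vertex stores its identifier, its neighbours' identifiers, the current
-- phase p, the round l within the phase, the transcript tr of the phase (tr s i is the
-- message received in round s from the neighbour with identifier i) and the result of
-- the last completed phase.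
module TheAlgorithm where

  open import Defs
  open CantorPairing
  open LastChange
  open ListTools
  open PrefixSums
  open import Data.Nat
  open import Data.Nat.Logarithm using (⌊log₂_⌋)
  open import Data.Bool using (Bool; false; if_then_else_; _∧_; not)
  open import Data.Maybe using (Maybe; just; nothing)
  open import Data.List using (List; []; length; _++_; replicate)
  open import Data.Product using (_×_; _,_; proj₁; proj₂)
  open import Relation.Binary.PropositionalEquality using (_≡_; refl)

  -- phase i uses the guess 2^i for max(D, ⌊log n⌋)
  guess : ℕ → ℕ
  guess i = 2 ^ i

  -- Schedule of a phase with guess G: rounds 0..G flood the minimum; in round
  -- upRound G q (q ≤ 2G) a vertex at depth d sends to its parent the count of class
  -- q - (G - d); in round downRound G q (q ≤ 2G) a vertex at depth d sends to its children
  -- the root count and the child's offset for class q - d.  Deeper vertices convergecast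
  -- earlier and shallower vertices broadcast earlier, so every value is ready in time.
  upRound : ℕ → ℕ → ℕ
  upRound G q = suc (G + q)

  downRound : ℕ → ℕ → ℕ
  downRound G q = upRound G (G + G) + suc q

  phaseLen : ℕ → ℕ
  phaseLen G = suc (downRound G (G + G))

  pointsTo : Maybe ℕ → ℕ → Bool
  pointsTo nothing i = false
  pointsTo (just p) i = p ≡ᵇ i

  module LocalRule (G me : ℕ) (ns : List ℕ) (tr : ℕ → ℕ → ℕ) where

    floodVal : ℕ → ℕ
    floodVal zero = me
    floodVal (suc s) = minOver (tr s) ns (floodVal s)

    leaderVal : ℕ
    leaderVal = floodVal G

    myDep : ℕ
    myDep = lastChange floodVal G

    nbDep : ℕ → ℕ
    nbDep i = lastChange (λ s → tr s i) G

    isParentCand : ℕ → Bool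
    isParentCand i = (tr G i ≡ᵇ leaderVal) ∧ (suc (nbDep i) ≡ᵇ myDep)

    parentId : Maybe ℕ
    parentId = if myDep ≡ᵇ 0 then nothing else firstM isParentCand ns

    myClass : ℕ
    myClass = ⌊log₂ length ns ⌋

    own : ℕ → ℕ
    own j = if myClass ≡ᵇ j then 1 else 0

    -- convergecast: the children's class counts received in round upRound G (q - 1), where a
    -- child sends 1 + count and a non-child 0; upVal q is the own subtree count sent in round q
    upSum : ℕ → ℕ
    upSum zero = 0
    upSum (suc q) = sumOver (λ i → tr (upRound G q) i ∸ 1) ns

    upJ : ℕ → ℕ
    upJ q = q ∸ (G ∸ myDep)

    upValid : ℕ → Bool
    upValid q = ((G ∸ myDep) ≤ᵇ q) ∧ (upJ q ≤ᵇ G)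

    upVal : ℕ → ℕ
    upVal q = own (upJ q) + upSum q

    upMsg : ℕ → ℕ → ℕ
    upMsg q i = if upValid q ∧ pointsTo parentId i then suc (upVal q) else 0

    -- children are recognised by a nonzero message in the first round they must report
    isCh : ℕ → Bool
    isCh i = not (tr (upRound G (G ∸ suc myDep)) i ≡ᵇ 0)

    chIds : List ℕ
    chIds = select isCh ns

    chCnt : ℕ → ℕ → ℕ
    chCnt j i = tr (upRound G ((G ∸ suc myDep) + j)) i ∸ 1

    -- broadcast: (root count , own offset) for class j, computed at a root or received
    -- (paired) from the parent
    dnInfoM : Maybe ℕ → ℕ → ℕ × ℕ
    dnInfoM nothing j = (upVal ((G ∸ myDep) + j) , 0)
    dnInfoM (just p) j = unpair (tr (downRound G ((myDep + j) ∸ 1)) p)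

    dnInfo : ℕ → ℕ × ℕ
    dnInfo = dnInfoM parentId

    dnJ : ℕ → ℕ
    dnJ q = q ∸ myDep

    dnValid : ℕ → Bool
    dnValid q = (myDep ≤ᵇ q) ∧ (dnJ q ≤ᵇ G)

    dnMsg : ℕ → ℕ → ℕ
    dnMsg q i = if dnValid q ∧ isCh i
      then pair (proj₁ (dnInfo (dnJ q))) (proj₂ (dnInfo (dnJ q)) + own (dnJ q) + sumBefore (λ x → x) (chCnt (dnJ q)) chIds i)
      else 0

    phaseSend : ℕ → ℕ → ℕ
    phaseSend s i = if s ≤ᵇ G then floodVal s else (if s ≤ᵇ upRound G (G + G) then upMsg (s ∸ suc G) i else dnMsg (s ∸ downRound G 0) i)

    blockStart : ℕ → ℕ
    blockStart zero = 0
    blockStart (suc j) = blockStart j + proj₁ (dnInfo j)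

    classTable : ℕ → List ℕ
    classTable zero = []
    classTable (suc j) = classTable j ++ replicate (proj₁ (dnInfo j)) j

    resID : ℕ
    resID = suc (blockStart myClass + proj₂ (dnInfo myClass))

    resInfo : List ℕ
    resInfo = classTable (suc G)

  record NodeState : Set where
    constructor mkSt
    field
      me  : ℕ
      ns  : List ℕ
      ph  : ℕ
      loc : ℕ
      tr  : ℕ → ℕ → ℕ
      res : Maybe (ℕ × List ℕ)
  open NodeState

  emptyTrace : ℕ → ℕ → ℕ
  emptyTrace _ _ = 0

  logRound : ℕ → (ℕ → ℕ → ℕ) → List (ℕ × ℕ) → ℕ → ℕ → ℕ
  logRound l t ms s i = if s ≡ᵇ l then keyLookup ms i else t s i

  -- The sending and result functions are kept opaque so that the states produced by the
  -- execution stay small terms; sendF-≡ and resF-≡ unfold them when needed.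
  opaque
    sendF : NodeState → ℕ → ℕ
    sendF st i = LocalRule.phaseSend (guess (ph st)) (me st) (ns st) (tr st) (loc st) i

    resF : ℕ → ℕ → List ℕ → (ℕ → ℕ → ℕ) → ℕ × List ℕ
    resF G a b t = (LocalRule.resID G a b t , LocalRule.resInfo G a b t)

  opaque
    unfolding sendF resF
    sendF-≡ : ∀ st i → sendF st i ≡ LocalRule.phaseSend (guess (ph st)) (me st) (ns st) (tr st) (loc st) i
    sendF-≡ st i = refl

    resF-≡ : ∀ G a b t → resF G a b t ≡ (LocalRule.resID G a b t , LocalRule.resInfo G a b t)
    resF-≡ G a b t = refl

  stepState : NodeState → List (ℕ × ℕ) → NodeState
  stepState (mkSt a b p l t r) ms =
    if suc l ≡ᵇ phaseLen (guess p)
    then mkSt a b (suc p) 0 emptyTrace (just (resF (guess p) a b (logRound l t ms)))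
    else mkSt a b p (suc l) (logRound l t ms) r

  alg : Algorithm
  alg = record
    { State = NodeState
    ; Info = List ℕ
    ; init = λ a b → mkSt a b 0 0 emptyTrace nothing
    ; send = sendF
    ; recv = stepState
    ; out = res
    ; decode = λ inf x → lookupD inf (pred x)
    }

-- Replay: at round phaseStart i + s every vertex is in phase i at local round s, and the
-- transcript it holds consists exactly of the messages it received in rounds
-- phaseStart i, …, phaseStart i + s - 1.  Hence the messages of the real execution are
-- the local rule applied to correct transcripts, and the result of phase i is computed
-- from the actual messages of that phase.
module Simulation where

  open import Defs
  open BoolComparisons
  open ListTools
  open TheAlgorithm
  open import Data.Nat
  open import Data.Nat.Properties
  open import Data.Bool using (true; false)
  open import Data.Empty using (⊥-elim)
  open import Data.Fin using (Fin)
  open import Data.Maybe using (Maybe; just; nothing)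
  open import Data.List using (List; map)
  open import Data.Product using (_×_; _,_; ∃-syntax)
  open import Relation.Binary.PropositionalEquality
  open import Data.List.Membership.Propositional using (_∈_)

  phaseStart : ℕ → ℕ
  phaseStart zero = 0
  phaseStart (suc i) = phaseStart i + phaseLen (guess i)

  module Replay {n : ℕ} (Gr : Graph n) (ids : Fin n → ℕ) (inj : ∀ x y → ids x ≡ ids y → x ≡ y) where
    open Run alg Gr ids

    TrOK : ℕ → Fin n → (ℕ → ℕ → ℕ) → ℕ → Set
    TrOK i v t s = ∀ s' → s' < s → ∀ w → w ∈ nbrs Gr v → t s' (ids w) ≡ msg (phaseStart i + s') w v

    -- the stored result is that of phase i - 1, computed from a correct full transcript
    ResOK : ℕ → Fin n → Maybe (ℕ × List ℕ) → Set
    ResOK zero v r = r ≡ nothing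
    ResOK (suc i) v r = ∃[ t ] (TrOK i v t (phaseLen (guess i)) ×
       r ≡ just (resF (guess i) (ids v) (nbrIds v) t))

    record Good (i s : ℕ) (v : Fin n) (st : NodeState) : Set where
      constructor good
      field
        g-me  : NodeState.me st ≡ ids v
        g-ns  : NodeState.ns st ≡ nbrIds v
        g-ph  : NodeState.ph st ≡ i
        g-loc : NodeState.loc st ≡ s
        g-tr  : TrOK i v (NodeState.tr st) s
        g-res : ResOK i v (NodeState.res st)

    inbox : ℕ → Fin n → List (ℕ × ℕ)
    inbox r v = map (λ u → ids u , send alg (state r u) (ids v)) (nbrs Gr v)

    inbox-ok : ∀ r v w → w ∈ nbrs Gr v → keyLookup (inbox r v) (ids w) ≡ msg r w v
    inbox-ok r v w m = keyLookup-map ids (λ u → send alg (state r u) (ids v)) inj (nbrs Gr v) m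

    logRound-ok : ∀ i v t s → TrOK i v t s → TrOK i v (logRound s t (inbox (phaseStart i + s) v)) (suc s)
    logRound-ok i v t s ok s' q w m with s' ≡ᵇ s in es
    ... | true = trans (inbox-ok (phaseStart i + s) v w m) (cong (λ z → msg (phaseStart i + z) w v) (sym (≡ᵇ-sound es)))
    ... | false = ok s' (≤∧≢⇒< (≤-pred q) (≡ᵇ-false es)) w m

    good-step : ∀ {i s v} st → Good i s v st → suc s < phaseLen (guess i) →
      Good i (suc s) v (stepState st (inbox (phaseStart i + s) v))
    good-step {i} {s} {v} (mkSt _ _ _ _ t r) (good refl refl refl refl ok res) lt
      with suc s ≡ᵇ phaseLen (guess i) in e
    ... | true = ⊥-elim (<-irrefl (≡ᵇ-sound e) lt)
    ... | false = good refl refl refl refl (logRound-ok i v t s ok) res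

    good-new : ∀ {i s v} st → Good i s v st → suc s ≡ phaseLen (guess i) →
      Good (suc i) 0 v (stepState st (inbox (phaseStart i + s) v))
    good-new {i} {s} {v} (mkSt _ _ _ _ t r) (good refl refl refl refl ok res) last
      with suc s ≡ᵇ phaseLen (guess i) in e
    ... | false = ⊥-elim (≡ᵇ-false e last)
    ... | true = good refl refl refl refl (λ s' ()) (_ , subst (TrOK i v (logRound s t (inbox (phaseStart i + s) v))) last (logRound-ok i v t s ok) , refl)

    replay : ∀ i s → s < phaseLen (guess i) → ∀ v → Good i s v (state (phaseStart i + s) v)
    replay zero zero p v = good refl refl refl refl (λ s' ()) refl
    replay (suc i) zero p v =
      subst (λ r → Good (suc i) 0 v (state r v)) (sym (trans (+-identityʳ _) (+-suc (phaseStart i) X)))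
        (good-new _ (replay i X ≤-refl v) refl)
      where X = pred (phaseLen (guess i))
    replay i (suc s) p v =
      subst (λ r → Good i (suc s) v (state r v)) (sym (+-suc (phaseStart i) s))
        (good-step _ (replay i s (<-trans (n<1+n s) p) v) p)

    send-view : ∀ {i s v} st → Good i s v st → ∀ x →
      send alg st x ≡ LocalRule.phaseSend (guess i) (ids v) (nbrIds v) (NodeState.tr st) s x
    send-view (mkSt _ _ _ _ t r) (good refl refl refl refl _ _) x = sendF-≡ _ x

-- Each stage is
-- proved by strong induction on its rounds: the messages of round s are those of a
-- specification (floodMin, upSpec, downSpec), because they are computed by the local rule
-- from a transcript of earlier rounds, which by induction are already specified.
module PhaseAnalysis where

  open import Defs
  open BoolComparisons
  open CantorPairing
  open LastChange
  open ListTools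
  open PrefixSums
  open Flooding
  open TreeNumbering
  open TheAlgorithm
  open Simulation
  open import Data.Nat
  open import Data.Nat.Properties
  open import Data.Nat.Logarithm using (⌊log₂_⌋)
  open import Data.Bool using (Bool; true; false; if_then_else_; _∧_; not; T?)
  open import Data.Empty using (⊥-elim)
  open import Data.Fin using (Fin)
  open import Data.Maybe using (Maybe; just; nothing)
  import Data.Maybe as Mb
  open import Data.List using (List; []; map; _++_; replicate)
  open import Data.List.Properties using (length-map)
  open import Data.Product using (_×_; _,_; proj₁; proj₂; ∃-syntax)
  open import Data.Sum using (_⊎_; inj₁; inj₂)
  open import Relation.Binary.PropositionalEquality
  open import Data.List.Membership.Propositional using (_∈_)
  open import Data.List.Relation.Unary.Unique.Propositional using (Unique)
  open import Data.List.Relation.Unary.Unique.Propositional.Properties using (filter⁺; allFin⁺)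
  open import Relation.Nullary using (yes; no)
  open import Function using (_∘_)

  -- a count (at most n) plus one fits below the paired-message bound (n ≥ 1 is witnessed
  -- by a vertex)
  suc≤pairBound : ∀ {m} → Fin m → suc m ≤ m + (m + m) * (m + m)
  suc≤pairBound {suc m} _ = ≤-trans (≤-reflexive (+-comm 1 (suc m))) (+-monoʳ-≤ (suc m) (≤-trans (s≤s z≤n) (m≤m+n (suc m + suc m) _)))

  module Phase {n : ℕ} (Gr : Graph n) (ids : Fin n → ℕ) (inj : ∀ x y → ids x ≡ ids y → x ≡ y) (i : ℕ) where
    open Run alg Gr ids
    open Replay Gr ids inj
    open WalkFacts Gr
    open MinFlood Gr ids

    G : ℕ
    G = guess i

    phaseMsg : ℕ → Fin n → Fin n → ℕ
    phaseMsg s w v = msg (phaseStart i + s) w v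

    msg-view : ∀ s → s < phaseLen G → ∀ w v → ∃[ t ] (TrOK i w t s × phaseMsg s w v ≡ LocalRule.phaseSend G (ids w) (nbrIds w) t s (ids v))
    msg-view s p w v = NodeState.tr st , Replay.Good.g-tr gd , send-view st gd (ids v)
      where
      gd = replay i s p w
      st = state (phaseStart i + s) w

    floodVal-correct : ∀ w t s → TrOK i w t s → (∀ s' → s' < s → ∀ u → phaseMsg s' u w ≡ floodMin s' u) →
      ∀ s'' → s'' ≤ s → LocalRule.floodVal G (ids w) (nbrIds w) t s'' ≡ floodMin s'' w
    floodVal-correct w t s ok fl zero _ = refl
    floodVal-correct w t s ok fl (suc s'') p =
      trans (minOver-map (t s'') ids (nbrs Gr w) _)
        (trans (cong (minOver (t s'' ∘ ids) (nbrs Gr w)) (floodVal-correct w t s ok fl s'' (≤-trans (n≤1+n _) p)))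
         (minOver-congM (nbrs Gr w) (floodMin s'' w) (λ u m → trans (ok s'' p u m) (fl s'' p u))))

    phaseLen-big : ∀ s → s ≤ suc (G + (G + G)) → s < phaseLen G
    phaseLen-big s p = s≤s (≤-trans p (m≤m+n _ _))

    flood-msgs-below : ∀ s → s ≤ suc G → ∀ s' → s' < s → ∀ w v → phaseMsg s' w v ≡ floodMin s' w
    flood-msgs-below zero p s' () w v
    flood-msgs-below (suc s) p s' q w v with msg-view s' (phaseLen-big s' (≤-trans (≤-pred q) (≤-trans (≤-pred p) (≤-trans (n≤1+n _) (s≤s (m≤m+n _ _)))))) w v
    ... | t , ok , e rewrite e | ≤ᵇ-true {s'} {G} (≤-trans (≤-pred q) (≤-pred p)) =
      floodVal-correct w t s' ok (λ s'' r u → flood-msgs-below s (≤-trans (n≤1+n _) p) s'' (≤-trans r (≤-pred q)) u w) s' ≤-refl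

    flood-msgs : ∀ s → s ≤ G → ∀ w v → phaseMsg s w v ≡ floodMin s w
    flood-msgs s p w v = flood-msgs-below (suc G) ≤-refl s (s≤s p) w v

    TrOK-≤ : ∀ {v t s s'} → TrOK i v t s → s' ≤ s → TrOK i v t s'
    TrOK-≤ ok p s'' q w m = ok s'' (≤-trans q p) w m

    depth : Fin n → ℕ
    depth v = lastChange (λ s → floodMin s v) G

    parentCand : Fin n → Fin n → Bool
    parentCand v w = (floodMin G w ≡ᵇ floodMin G v) ∧ (suc (depth w) ≡ᵇ depth v)

    parent : Fin n → Maybe (Fin n)
    parent v = if depth v ≡ᵇ 0 then nothing else firstM (parentCand v) (nbrs Gr v)

    degClass : Fin n → ℕ
    degClass v = ⌊log₂ deg Gr v ⌋

    module AfterFlood (v : Fin n) (t : ℕ → ℕ → ℕ) (s : ℕ) (ok : TrOK i v t s) (big : suc G ≤ s) where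
      module L = LocalRule G (ids v) (nbrIds v) t

      floodOK : TrOK i v t (suc G)
      floodOK = TrOK-≤ {v} {t} ok big

      floodVal≡ : ∀ s'' → s'' ≤ suc G → L.floodVal s'' ≡ floodMin s'' v
      floodVal≡ = floodVal-correct v t (suc G) floodOK (λ s' p u → flood-msgs-below (suc G) ≤-refl s' p u v)

      myDep≡ : L.myDep ≡ depth v
      myDep≡ = lastChange-cong L.floodVal (λ s → floodMin s v) G (λ r p → floodVal≡ r (≤-trans p (n≤1+n G)))

      leaderVal≡ : L.leaderVal ≡ floodMin G v
      leaderVal≡ = floodVal≡ G (n≤1+n G)

      nbrFlood≡ : ∀ s' → s' ≤ G → ∀ w → w ∈ nbrs Gr v → t s' (ids w) ≡ floodMin s' w
      nbrFlood≡ s' p w m = trans (floodOK s' (s≤s p) w m) (flood-msgs s' p w v)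

      nbrDep≡ : ∀ w → w ∈ nbrs Gr v → L.nbDep (ids w) ≡ depth w
      nbrDep≡ w m = lastChange-cong (λ s' → t s' (ids w)) (λ s' → floodMin s' w) G (λ r p → nbrFlood≡ r p w m)

      isParentCand≡ : ∀ w → w ∈ nbrs Gr v → L.isParentCand (ids w) ≡ parentCand v w
      isParentCand≡ w m rewrite nbrFlood≡ G ≤-refl w m | leaderVal≡ | nbrDep≡ w m | myDep≡ = refl

      parentId≡ : L.parentId ≡ Mb.map ids (parent v)
      parentId≡ = trans (cong (λ d → if d ≡ᵇ 0 then nothing else firstM L.isParentCand (nbrIds v)) myDep≡) rest
        where
        rest : (if depth v ≡ᵇ 0 then nothing else firstM L.isParentCand (nbrIds v)) ≡ Mb.map ids (parent v)
        rest with depth v ≡ᵇ 0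
        ... | true = refl
        ... | false = trans (firstM-map L.isParentCand ids (nbrs Gr v)) (cong (Mb.map ids) (firstM-congM (nbrs Gr v) isParentCand≡))

      myClass≡ : L.myClass ≡ degClass v
      myClass≡ = cong ⌊log₂_⌋ (length-map ids (nbrs Gr v))

      own≡ : ∀ j → L.own j ≡ (if degClass v ≡ᵇ j then 1 else 0)
      own≡ j rewrite myClass≡ = refl

    parent-dep : ∀ c w → parent c ≡ just w → suc (depth w) ≡ depth c
    parent-dep c w e with depth c ≡ᵇ 0
    ... | false = ≡ᵇ-sound (proj₂ (∧-true (proj₂ (firstM-sound (parentCand c) (nbrs Gr c) e))))

    parent-nb : ∀ c w → parent c ≡ just w → c ∈ nbrs Gr w
    parent-nb c w e with depth c ≡ᵇ 0
    ... | false = adj⇒nbr (adjT-sym (nbr⇒adj (proj₁ (firstM-sound (parentCand c) (nbrs Gr c) e))))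

    depth-≤ : ∀ v → depth v ≤ G
    depth-≤ v = lastChange-≤ (λ s → floodMin s v) G

    nb-uniq : ∀ w → Unique (nbrs Gr w)
    nb-uniq w = filter⁺ (λ x → T? (adj Gr w x)) (allFin⁺ n)

    open Forest ids inj (nbrs Gr) nb-uniq parent depth G degClass parent-dep parent-nb depth-≤ public

    upActive : ℕ → Fin n → Bool
    upActive q w = ((G ∸ depth w) ≤ᵇ q) ∧ ((q ∸ (G ∸ depth w)) ≤ᵇ G)

    upActive-sound : ∀ {q w} → upActive q w ≡ true → (G ∸ depth w ≤ q) × (q ∸ (G ∸ depth w) ≤ G)
    upActive-sound {q} {w} e = ≤ᵇ-sound {G ∸ depth w} {q} (proj₁ (∧-true {(G ∸ depth w) ≤ᵇ q} e)) ,
                               ≤ᵇ-sound {q ∸ (G ∸ depth w)} {G} (proj₂ (∧-true {(G ∸ depth w) ≤ᵇ q} e))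

    upSpec : ℕ → Fin n → Fin n → ℕ
    upSpec q w v = if upActive q w ∧ isPar ids (parent w) v then suc (cnt (q ∸ (G ∸ depth w)) w) else 0

    dep-lt : ∀ {w u} → parent u ≡ just w → depth w < G
    dep-lt {w} {u} e = ≤-trans (≤-reflexive (parent-dep u w e)) (depth-≤ u)

    G∸-suc : ∀ {d} → d < G → G ∸ d ≡ suc (G ∸ suc d)
    G∸-suc {d} p = trans (sym (suc-pred (G ∸ d) ⦃ >-nonZero (m<n⇒0<n∸m p) ⦄)) (cong suc (pred[m∸n]≡m∸[1+n] G d))

    upMsg-count-child : ∀ q' w u → G ∸ depth w ≤ suc q' → suc q' ∸ (G ∸ depth w) ≤ G → isPar ids (parent u) w ≡ true →
      upSpec q' u w ∸ 1 ≡ cnt (suc q' ∸ (G ∸ depth w)) u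
    upMsg-count-child q' w u p1 p2 e = trans (cong (_∸ 1) (cong₂ (λ b1 b2 → if b1 ∧ b2 then suc (cnt (q' ∸ (G ∸ depth u)) u) else 0)
                       (cong₂ _∧_ (≤ᵇ-true v1) (≤ᵇ-true v2)) e)) (cong (λ z → cnt z u) (sym jj))
      where
      pe = isPar-just e
      du : depth u ≡ suc (depth w)
      du = sym (parent-dep u w pe)
      gw : G ∸ depth w ≡ suc (G ∸ depth u)
      gw = trans (G∸-suc (dep-lt pe)) (cong (λ z → suc (G ∸ z)) (sym du))
      jj : suc q' ∸ (G ∸ depth w) ≡ q' ∸ (G ∸ depth u)
      jj rewrite gw = refl
      v1 : (G ∸ depth u) ≤ q'
      v1 = ≤-pred (subst (_≤ suc q') gw p1)
      v2 : q' ∸ (G ∸ depth u) ≤ G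
      v2 = subst (_≤ G) jj p2

    upMsg-count : ∀ q' w u → G ∸ depth w ≤ suc q' → suc q' ∸ (G ∸ depth w) ≤ G →
      upSpec q' u w ∸ 1 ≡ (if isPar ids (parent u) w then cnt (suc q' ∸ (G ∸ depth w)) u else 0)
    upMsg-count q' w u p1 p2 = aux (isPar ids (parent u) w) refl
      where
      aux : ∀ b → isPar ids (parent u) w ≡ b → upSpec q' u w ∸ 1 ≡ (if b then cnt (suc q' ∸ (G ∸ depth w)) u else 0)
      aux true e = upMsg-count-child q' w u p1 p2 e
      aux false e = trans (cong (λ b → (if upActive q' u ∧ b then suc (cnt (q' ∸ (G ∸ depth u)) u) else 0) ∸ 1) e)
                          (cong (λ x → (if x then suc (cnt (q' ∸ (G ∸ depth u)) u) else 0) ∸ 1) (∧-false (upActive q' u)))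

    upVal-correct : ∀ q w t → TrOK i w t (suc (G + q)) → (∀ q' → q' < q → ∀ u v → phaseMsg (suc (G + q')) u v ≡ upSpec q' u v) →
      G ∸ depth w ≤ q → q ∸ (G ∸ depth w) ≤ G →
      LocalRule.upVal G (ids w) (nbrIds w) t q ≡ cnt (q ∸ (G ∸ depth w)) w
    upVal-correct q w t ok ih p1 p2 = trans (cong₂ _+_ ownE (sumE q ok ih p1 p2)) (sym (cnt-rec _ w))
      where
      open AfterFlood w t (suc (G + q)) ok (s≤s (m≤m+n G q))
      ownE : L.own (L.upJ q) ≡ own (q ∸ (G ∸ depth w)) w
      ownE rewrite myDep≡ = own≡ _
      sumE : ∀ q → TrOK i w t (suc (G + q)) → (∀ q' → q' < q → ∀ u v → phaseMsg (suc (G + q')) u v ≡ upSpec q' u v) →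
        G ∸ depth w ≤ q → q ∸ (G ∸ depth w) ≤ G →
        LocalRule.upSum G (ids w) (nbrIds w) t q ≡ sumOver (cnt (q ∸ (G ∸ depth w))) (ch w)
      sumE zero ok ih p1 p2 = sym (sumOver-zero _ (ch w) (λ c m → ⊥-elim (ch-nodeep (m∸n≡0⇒m≤n (n≤0⇒n≡0 p1)) m)))
      sumE (suc q') ok ih p1 p2 =
        trans (sumOver-map (λ x → t (suc (G + q')) x ∸ 1) ids (nbrs Gr w))
        (trans (sumOver-congM (nbrs Gr w) (λ u m → cong (_∸ 1) (trans (ok (suc (G + q')) (s≤s (+-monoʳ-< G ≤-refl)) u m) (ih q' ≤-refl u w))))
        (trans (sumOver-congM (nbrs Gr w) (λ u m → upMsg-count q' w u p1 p2))
        (sym (sumOver-select _ (cnt (suc q' ∸ (G ∸ depth w))) (nbrs Gr w)))))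

    pointsTo-map : ∀ m v → pointsTo (Mb.map ids m) (ids v) ≡ isPar ids m v
    pointsTo-map nothing v = refl
    pointsTo-map (just x) v = refl

    phaseSend-up : ∀ (me : ℕ) ns t q → q ≤ G + G → ∀ x →
      LocalRule.phaseSend G me ns t (suc (G + q)) x ≡ LocalRule.upMsg G me ns t q x
    phaseSend-up me ns t q p x rewrite ≤ᵇ-false {suc (G + q)} {G} (λ r → 1+n≰n (≤-trans r (m≤m+n G q)))
      | ≤ᵇ-true {suc (G + q)} {suc (G + (G + G))} (s≤s (+-monoʳ-≤ G p)) | m+n∸m≡n G q = refl

    up-msgs-below : ∀ q → q ≤ suc (G + G) → ∀ q' → q' < q → ∀ u v → phaseMsg (suc (G + q')) u v ≡ upSpec q' u v
    up-msgs-below (suc q) p q' r u v with msg-view (suc (G + q')) (phaseLen-big _ (s≤s (+-monoʳ-≤ G (≤-trans (≤-pred r) (≤-pred p))))) u v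
    ... | t , ok , e = trans e (trans (phaseSend-up (ids u) (nbrIds u) t q' (≤-trans (≤-pred r) (≤-pred p)) (ids v))
          (if-cong (cong₂ _∧_ (cong (λ d → ((G ∸ d) ≤ᵇ q') ∧ ((q' ∸ (G ∸ d)) ≤ᵇ G)) myDep≡)
                               (trans (cong (λ m → pointsTo m (ids v)) parentId≡) (pointsTo-map (parent u) v)))
            (λ b → let act = upActive-sound {q'} {u} (proj₁ (∧-true {upActive q' u} b)) in
              cong suc (upVal-correct q' u t ok (λ q'' r' → up-msgs-below q (≤-trans (n≤1+n _) p) q'' (≤-trans r' (≤-pred r)))
                                      (proj₁ act) (proj₂ act)))))
      where open AfterFlood u t (suc (G + q')) ok (s≤s (m≤m+n G q'))

    up-msgs : ∀ q → q ≤ G + G → ∀ u v → phaseMsg (suc (G + q)) u v ≡ upSpec q u v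
    up-msgs q p = up-msgs-below (suc q) (s≤s p) q ≤-refl

    downActive : ℕ → Fin n → Bool
    downActive q w = (depth w ≤ᵇ q) ∧ ((q ∸ depth w) ≤ᵇ G)

    downActive-sound : ∀ {q w} → downActive q w ≡ true → (depth w ≤ q) × (q ∸ depth w ≤ G)
    downActive-sound {q} {w} e = ≤ᵇ-sound {depth w} {q} (proj₁ (∧-true {depth w ≤ᵇ q} e)) ,
                                 ≤ᵇ-sound {q ∸ depth w} {G} (proj₂ (∧-true {depth w ≤ᵇ q} e))

    downSpec : ℕ → Fin n → Fin n → ℕ
    downSpec q w v = if downActive q w ∧ isPar ids (parent v) w then pair (rootCnt (q ∸ depth w) w) (off (q ∸ depth w) v) else 0

    upEnd : ℕ
    upEnd = upRound G (G + G)

    downAt : ℕ → ℕ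
    downAt = downRound G

    phaseSend-down : ∀ (me : ℕ) ns t q x → LocalRule.phaseSend G me ns t (downAt q) x ≡ LocalRule.dnMsg G me ns t q x
    phaseSend-down me ns t q x rewrite ≤ᵇ-false {downAt q} {G} (<⇒≱ (≤-trans (s≤s (m≤m+n G (G + G))) (m≤m+n upEnd (suc q))))
      | ≤ᵇ-false {downAt q} {upEnd} (<⇒≱ (m<m+n upEnd (s≤s z≤n)))
      | [m+n]∸[m+o]≡n∸o upEnd (suc q) 1 = refl

    module AfterConvergecast (w : Fin n) (t : ℕ → ℕ → ℕ) (s : ℕ) (ok : TrOK i w t s) (big : suc upEnd ≤ s) where
      open AfterFlood w t s ok (≤-trans (≤-trans (s≤s (m≤m+n G (G + G))) (n≤1+n _)) big) public

      upReceived : ∀ q → q ≤ G + G → ∀ u → u ∈ nbrs Gr w → t (suc (G + q)) (ids u) ≡ upSpec q u w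
      upReceived q p u m = trans (ok (suc (G + q)) (≤-trans (s≤s (s≤s (+-monoʳ-≤ G p))) big) u m) (up-msgs q p u w)

      q0 : ℕ
      q0 = G ∸ suc (depth w)

      q0-≤ : q0 ≤ G + G
      q0-≤ = ≤-trans (m∸n≤m G (suc (depth w))) (m≤m+n G G)

      isCh≡ : ∀ u → u ∈ nbrs Gr w → L.isCh (ids u) ≡ isPar ids (parent u) w
      isCh≡ u m = trans (cong (λ d → not (t (suc (G + (G ∸ suc d))) (ids u) ≡ᵇ 0)) myDep≡)
                    (trans (cong (λ z → not (z ≡ᵇ 0)) (upReceived q0 q0-≤ u m)) (aux (isPar ids (parent u) w) refl))
        where
        aux : ∀ b → isPar ids (parent u) w ≡ b → not (upSpec q0 u w ≡ᵇ 0) ≡ b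
        aux false e rewrite e | ∧-false (upActive q0 u) = refl
        aux true e rewrite e | sym (parent-dep u w (isPar-just e)) | n∸n≡0 (G ∸ suc (depth w)) | ≤ᵇ-true {0} {G} z≤n | ≤ᵇ-true {G ∸ suc (depth w)} {G ∸ suc (depth w)} ≤-refl = refl

      chIds≡ : L.chIds ≡ map ids (ch w)
      chIds≡ = trans (select-map L.isCh ids (nbrs Gr w)) (cong (map ids) (select-congM (nbrs Gr w) isCh≡))

      chCnt≡ : ∀ j → j ≤ G → ∀ u → u ∈ ch w → L.chCnt j (ids u) ≡ cnt j u
      chCnt≡ j p u m = trans (cong (λ d → t (suc (G + ((G ∸ suc d) + j))) (ids u) ∸ 1) myDep≡)
                         (trans (cong (_∸ 1) (upReceived (q0 + j) (+-mono-≤ (m∸n≤m G (suc (depth w))) p) u (proj₁ (select-∈⁻ _ (nbrs Gr w) m))))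
                         (childReport))
        where
        e = ch⇒par m
        childReport : upSpec (q0 + j) u w ∸ 1 ≡ cnt j u
        childReport rewrite e | ≡ᵇ-refl (ids w) | sym (parent-dep u w e) | ≤ᵇ-true (m≤m+n (G ∸ suc (depth w)) j)
              | m+n∸m≡n (G ∸ suc (depth w)) j | ≤ᵇ-true p = refl

      sumBefore≡ : ∀ j → j ≤ G → ∀ v → sumBefore (λ x → x) (L.chCnt j) L.chIds (ids v) ≡ sumBefore ids (cnt j) (ch w) v
      sumBefore≡ j p v = trans (cong (λ xs → sumBefore (λ x → x) (L.chCnt j) xs (ids v)) chIds≡)
                     (trans (sumBefore-map ids (L.chCnt j) (ch w) v) (sumBefore-congM ids (ch w) v (λ u m → chCnt≡ j p u m)))

      upVal≡ : ∀ j → j ≤ G → L.upVal ((G ∸ depth w) + j) ≡ cnt j w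
      upVal≡ j p = trans (upVal-correct ((G ∸ depth w) + j) w t (TrOK-≤ {w} {t} ok (≤-trans (s≤s (+-monoʳ-≤ G (+-mono-≤ (m∸n≤m G (depth w)) p))) (≤-trans (n≤1+n _) big)))
                        (λ q' r u v → up-msgs q' (≤-trans (<⇒≤ r) (+-mono-≤ (m∸n≤m G (depth w)) p)) u v)
                        (m≤m+n (G ∸ depth w) j) (≤-trans (≤-reflexive (m+n∸m≡n (G ∸ depth w) j)) p))
                     (cong (λ z → cnt z w) (m+n∸m≡n (G ∸ depth w) j))

      DownIH : ℕ → Set
      DownIH q = ∀ q'' → q'' < q → ∀ w' v' → v' ∈ nbrs Gr w' → phaseMsg (downAt q'') w' v' ≡ downSpec q'' w' v'

      -- w learns (rootCnt j w , off j w): at a root by its own count, otherwise from the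
      -- parent's message in down-round depth w + j - 1
      downInfo≡ : ∀ j → j ≤ G → downAt (depth w + j) ≤ s → DownIH (depth w + j) → L.dnInfo j ≡ (rootCnt j w , off j w)
      downInfo≡ j p cov ih = trans (cong (λ m → L.dnInfoM m j) parentId≡) (aux (parent w) refl)
        where
        aux : ∀ m → parent w ≡ m → L.dnInfoM (Mb.map ids m) j ≡ (rootCnt j w , off j w)
        aux nothing e = cong₂ _,_ (trans (cong (λ d → L.upVal ((G ∸ d) + j)) myDep≡) (trans (upVal≡ j p) (sym (rootCnt-root {j} {w} e))))
                                  (sym (off-root {j} {w} e))
        aux (just pp) e = trans (cong (λ d → unpair (t (downAt ((d + j) ∸ 1)) (ids pp))) (trans myDep≡ (sym pd))) rest
          where
          pd = parent-dep w pp e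
          ppn : pp ∈ nbrs Gr w
          ppn = adj⇒nbr (adjT-sym (nbr⇒adj (parent-nb w pp e)))
          cov' : suc (downAt (depth pp + j)) ≤ s
          cov' = ≤-trans (≤-reflexive (sym (+-suc upEnd (suc (depth pp + j))))) (subst (λ d → downAt (d + j) ≤ s) (sym pd) cov)
          rest : unpair (t (downAt (depth pp + j)) (ids pp)) ≡ (rootCnt j w , off j w)
          rest =
            trans (cong unpair (ok (downAt (depth pp + j)) cov' pp ppn))
            (trans (cong unpair (ih (depth pp + j) (subst (λ d → depth pp + j < d + j) pd ≤-refl) pp w (parent-nb w pp e)))
            (trans (cong unpair (if-cong {x' = pair (rootCnt j pp) (off j w)} {y = 0}
                     (cong₂ _∧_ (cong₂ _∧_ (≤ᵇ-true (m≤m+n (depth pp) j)) (trans (cong (_≤ᵇ G) (m+n∸m≡n (depth pp) j)) (≤ᵇ-true p)))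
                                (trans (cong (λ m → isPar ids m pp) e) (≡ᵇ-refl (ids pp))))
                     (λ _ → cong₂ pair (cong (λ z → rootCnt z pp) (m+n∸m≡n (depth pp) j)) (cong (λ z → off z w) (m+n∸m≡n (depth pp) j)))))
            (trans (unpair-pair _ _) (cong (_, off j w) (sym (rootCnt-rec {j} e))))))

    down-msgs-below : ∀ q → q ≤ suc (G + G) → ∀ q' → q' < q → ∀ w v → v ∈ nbrs Gr w → phaseMsg (downAt q') w v ≡ downSpec q' w v
    down-msgs-below (suc q) p q' r w v mv with msg-view (downAt q') (s≤s (+-monoʳ-≤ upEnd (≤-trans r p))) w v
    ... | t , ok , e = trans e (trans (phaseSend-down (ids w) (nbrIds w) t q' (ids v))
          (if-cong (cong₂ _∧_ (cong (λ d → (d ≤ᵇ q') ∧ ((q' ∸ d) ≤ᵇ G)) myDep≡) (isCh≡ v mv))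
            (λ b → let act = downActive-sound {q'} {w} (proj₁ (∧-true {downActive q' w} b)) in
              body (proj₁ act) (proj₂ act) (isPar-just (proj₂ (∧-true {downActive q' w} b))))))
      where
      open AfterConvergecast w t (downAt q') ok (≤-trans (≤-reflexive (+-comm 1 upEnd)) (+-monoʳ-≤ upEnd (s≤s z≤n)))
      body : depth w ≤ q' → q' ∸ depth w ≤ G → parent v ≡ just w →
        pair (proj₁ (L.dnInfo (L.dnJ q'))) (proj₂ (L.dnInfo (L.dnJ q')) + L.own (L.dnJ q') + sumBefore (λ x → x) (L.chCnt (L.dnJ q')) L.chIds (ids v))
        ≡ pair (rootCnt (q' ∸ depth w) w) (off (q' ∸ depth w) v)
      body p1 p2 pv = trans (cong (λ d → pair (proj₁ (L.dnInfo (q' ∸ d))) (proj₂ (L.dnInfo (q' ∸ d)) + L.own (q' ∸ d) + sumBefore (λ x → x) (L.chCnt (q' ∸ d)) L.chIds (ids v))) myDep≡)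
        (cong₂ pair (cong proj₁ di) (trans (cong₂ _+_ (cong₂ _+_ (cong proj₂ di) (own≡ j)) (sumBefore≡ j p2 v)) (sym (off-rec pv))))
        where
        j = q' ∸ depth w
        di : L.dnInfo j ≡ (rootCnt j w , off j w)
        di = downInfo≡ j p2 (≤-reflexive (cong downAt (m+[n∸m]≡n p1)))
               (λ q'' r'' w' v' m' → down-msgs-below q (≤-trans (n≤1+n _) p) q'' (≤-trans (≤-trans r'' (≤-reflexive (m+[n∸m]≡n p1))) (≤-pred r)) w' v' m')

    down-msgs : ∀ q → q ≤ G + G → ∀ w v → v ∈ nbrs Gr w → phaseMsg (downAt q) w v ≡ downSpec q w v
    down-msgs q p = down-msgs-below (suc q) (s≤s p) q ≤-refl

    blockStartSpec : Fin n → ℕ → ℕ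
    blockStartSpec v zero = 0
    blockStartSpec v (suc j) = blockStartSpec v j + rootCnt j v

    classTableSpec : Fin n → ℕ → List ℕ
    classTableSpec v zero = []
    classTableSpec v (suc j) = classTableSpec v j ++ replicate (rootCnt j v) j

    module PhaseResult (v : Fin n) (t : ℕ → ℕ → ℕ) (ok : TrOK i v t (phaseLen G)) where
      open AfterConvergecast v t (phaseLen G) ok (s≤s (m≤m+n upEnd (suc (G + G))))

      downInfo-end : ∀ j → j ≤ G → L.dnInfo j ≡ (rootCnt j v , off j v)
      downInfo-end j p = downInfo≡ j p (≤-trans (+-monoʳ-≤ upEnd (s≤s (+-mono-≤ (depth-≤ v) p))) (n≤1+n _))
                 (λ q'' r w' v' m' → down-msgs q'' (<⇒≤ (≤-trans r (+-mono-≤ (depth-≤ v) p))) w' v' m')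

      blockStart≡ : ∀ j → j ≤ suc G → L.blockStart j ≡ blockStartSpec v j
      blockStart≡ zero p = refl
      blockStart≡ (suc j) p = cong₂ _+_ (blockStart≡ j (≤-trans (n≤1+n _) p)) (cong proj₁ (downInfo-end j (≤-pred p)))

      classTable≡ : ∀ j → j ≤ suc G → L.classTable j ≡ classTableSpec v j
      classTable≡ zero p = refl
      classTable≡ (suc j) p = cong₂ _++_ (classTable≡ j (≤-trans (n≤1+n _) p)) (cong (λ z → replicate z j) (cong proj₁ (downInfo-end j (≤-pred p))))

      resID≡ : degClass v ≤ G → L.resID ≡ suc (blockStartSpec v (degClass v) + off (degClass v) v)
      resID≡ p = trans (cong (λ c → suc (L.blockStart c + proj₂ (L.dnInfo c))) myClass≡)
                   (cong suc (cong₂ _+_ (blockStart≡ (degClass v) (≤-trans p (n≤1+n _))) (cong proj₂ (downInfo-end (degClass v) p))))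

      resInfo≡ : L.resInfo ≡ classTableSpec v (suc G)
      resInfo≡ = classTable≡ (suc G) ≤-refl

    msgBnd : ℕ
    msgBnd = n + (n + n) * (n + n)

    msgBound : ∀ s → s < phaseLen G → ∀ w v → v ∈ nbrs Gr w → (∃[ u ] (phaseMsg s w v ≡ ids u)) ⊎ (phaseMsg s w v ≤ msgBnd)
    msgBound s p w v mv with s ≤? G
    ... | yes q = inj₁ (proj₁ (floodMin-wit s w) , trans (flood-msgs s q w v) (proj₁ (proj₂ (floodMin-wit s w))))
    ... | no q with s ≤? upEnd
    ...   | yes q2 = inj₂ (subst (λ z → phaseMsg z w v ≤ msgBnd) se
                    (subst (_≤ msgBnd) (sym (up-msgs qq qq≤ w v))
                       (if-≤ (upActive qq w ∧ isPar ids (parent w) v) (λ _ → ≤-trans (s≤s (cnt-≤n _ w)) (suc≤pairBound w)))))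
      where
      qq = s ∸ suc G
      se : suc (G + qq) ≡ s
      se = m+[n∸m]≡n (≰⇒> q)
      qq≤ : qq ≤ G + G
      qq≤ = m≤n+o⇒m∸n≤o s (suc G) q2
    ...   | no q3 = inj₂ (subst (λ z → phaseMsg z w v ≤ msgBnd) se
                    (subst (_≤ msgBnd) (sym (down-msgs qq qq≤ w v mv))
                       (if-≤ (downActive qq w ∧ isPar ids (parent v) w)
                          (λ b → pair-≤ (proj₂ (rootCnt-bound (qq ∸ depth w) w))
                                    (≤-trans (m≤m+n _ _) (≤-trans (proj₁ (rootCnt-bound (qq ∸ depth w) v))
                                      (≤-trans (≤-reflexive (rootCnt-rec (isPar-just (proj₂ (∧-true {downActive qq w} b)))))
                                        (proj₂ (rootCnt-bound (qq ∸ depth w) w)))))))))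
      where
      qq = s ∸ suc upEnd
      se : downAt qq ≡ s
      se = trans (+-suc upEnd qq) (m+[n∸m]≡n (≰⇒> q3))
      qq≤ : qq ≤ G + G
      qq≤ = m≤n+o⇒m∸n≤o s (suc upEnd) (≤-trans (≤-pred p) (≤-reflexive (+-suc upEnd (G + G))))

-- Once the guess G satisfies D ≤ G and ⌊log n⌋ ≤ G, the flooding elects
-- the vertex L of minimum identifier, depths are distances from L, every vertex is
-- linked to L by parent pointers, and the phase outputs the Ranking of this single tree;
-- moreover two large phases compute the same depths, parents, counts and offsets, hence
-- the same output.
module StablePhases where

  open import Defs
  open BoolComparisons
  open ListTools
  open PrefixSums
  open Flooding
  open TreeNumbering
  open TheAlgorithm
  open Simulation
  open PhaseAnalysis
  open import Data.Nat
  open import Data.Nat.Properties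
  open import Data.Nat.Logarithm using (⌊log₂_⌋; ⌊log₂⌋-mono-≤)
  open import Data.Bool using (true; if_then_else_)
  open import Data.Empty using (⊥-elim)
  open import Data.Fin using (Fin)
  open import Data.Maybe using (Maybe; just; nothing)
  open import Data.List using (List; map; _++_; replicate)
  open import Data.Product using (_,_; ∃-syntax)
  open import Relation.Binary.PropositionalEquality
  open import Data.List.Membership.Propositional using (_∈_)

  module LargePhase {n : ℕ} (Gr : Graph n) (ids : Fin n → ℕ) (inj : ∀ x y → ids x ≡ ids y → x ≡ y)
    (D : ℕ) (diam : IsDiameter Gr D) (L : Fin n) (Lmin : ∀ u → ids L ≤ ids u)
    (i : ℕ) (GD : D ≤ guess i) (Glg : ⌊log₂ n ⌋ ≤ guess i) where
    open FloodFromMin Gr ids inj D diam L Lmin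
    open Phase Gr ids inj i
    open WalkFacts Gr
    open MinFlood Gr ids

    depth-isDistance : ∀ v → IsDistance v (depth v)
    depth-isDistance v = lastChange-distance G GD v

    depth-L : depth L ≡ 0
    depth-L = isDistance-unique (depth-isDistance L) isDistance-L

    leader-root : parent L ≡ nothing
    leader-root rewrite depth-L = refl

    parent-exists : ∀ v d → depth v ≡ suc d → ∃[ w ] (parent v ≡ just w)
    parent-exists v d e with isDistance-pred (subst (IsDistance v) e (depth-isDistance v))
    ... | w , a , dw = subst (λ z → ∃[ w' ] (z ≡ just w')) (sym pe) (firstM-complete (parentCand v) (nbrs Gr v) (adj⇒nbr (adjT-sym a)) cw)
      where
      pe : parent v ≡ firstM (parentCand v) (nbrs Gr v)
      pe rewrite e = refl
      cw : parentCand v w ≡ true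
      cw rewrite leader-settled G GD w | leader-settled G GD v | ≡ᵇ-refl (ids L) | isDistance-unique (depth-isDistance w) dw | e = ≡ᵇ-refl d

    reaches-leader-d : ∀ d v → depth v ≡ d → ∃[ k ] (anc k v ≡ just L)
    reaches-leader-d zero v e = 0 , cong just (isDistance-0 (subst (IsDistance v) e (depth-isDistance v)))
    reaches-leader-d (suc d) v e with parent-exists v d e
    ... | w , pw with reaches-leader-d d w (suc-injective (trans (parent-dep v w pw) e))
    ...   | k , ak = suc k , trans (anc-shift k v) (trans (cong (λ m → bindM m (anc k)) pw) ak)

    reaches-leader : ∀ v → ∃[ k ] (anc k v ≡ just L)
    reaches-leader v = reaches-leader-d (depth v) v refl

    degClass-≤ : ∀ v → degClass v ≤ G
    degClass-≤ v = ≤-trans (⌊log₂⌋-mono-≤ (deg-≤ Gr v)) Glg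

    open Ranking L leader-root reaches-leader G degClass-≤ public

    rootCnt-classSize-d : ∀ j d v → depth v ≡ d → rootCnt j v ≡ classSize j
    rootCnt-classSize-d j zero v e rewrite isDistance-0 (subst (IsDistance v) e (depth-isDistance v)) = rootCnt-root {j} {L} leader-root
    rootCnt-classSize-d j (suc d) v e with parent-exists v d e
    ... | w , pw = trans (rootCnt-rec {j} pw) (rootCnt-classSize-d j d w (suc-injective (trans (parent-dep v w pw) e)))

    rootCnt-classSize : ∀ j v → rootCnt j v ≡ classSize j
    rootCnt-classSize j v = rootCnt-classSize-d j (depth v) v refl

    blockStartSpec≡ : ∀ v j → blockStartSpec v j ≡ B j
    blockStartSpec≡ v zero = refl
    blockStartSpec≡ v (suc j) = cong₂ _+_ (blockStartSpec≡ v j) (rootCnt-classSize j v)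

    classTableSpec≡ : ∀ v j → classTableSpec v j ≡ blk j
    classTableSpec≡ v zero = refl
    classTableSpec≡ v (suc j) = cong₂ _++_ (classTableSpec≡ v j) (cong (λ z → replicate z j) (rootCnt-classSize j v))

    phase-result : ∀ v t → Replay.TrOK Gr ids inj i v t (phaseLen G) →
      (LocalRule.resID G (ids v) (map ids (nbrs Gr v)) t , LocalRule.resInfo G (ids v) (map ids (nbrs Gr v)) t) ≡ (ID v , info)
    phase-result v t ok = cong₂ _,_ (trans (PhaseResult.resID≡ v t ok (degClass-≤ v)) (cong (λ z → suc (z + off (degClass v) v)) (blockStartSpec≡ v (degClass v))))
                              (trans (PhaseResult.resInfo≡ v t ok) (classTableSpec≡ v (suc G)))

  module PhaseAgreement {n : ℕ} (Gr : Graph n) (ids : Fin n → ℕ) (inj : ∀ x y → ids x ≡ ids y → x ≡ y)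
    (D : ℕ) (diam : IsDiameter Gr D) (L : Fin n) (Lmin : ∀ u → ids L ≤ ids u)
    (i1 : ℕ) (GD1 : D ≤ guess i1) (Glg1 : ⌊log₂ n ⌋ ≤ guess i1)
    (i2 : ℕ) (GD2 : D ≤ guess i2) (Glg2 : ⌊log₂ n ⌋ ≤ guess i2) (i12 : guess i1 ≤ guess i2) where
    open FloodFromMin Gr ids inj D diam L Lmin
    module P1 = LargePhase Gr ids inj D diam L Lmin i1 GD1 Glg1
    module P2 = LargePhase Gr ids inj D diam L Lmin i2 GD2 Glg2
    module Ph1 = Phase Gr ids inj i1
    module Ph2 = Phase Gr ids inj i2

    depth≡ : ∀ v → Ph1.depth v ≡ Ph2.depth v
    depth≡ v = isDistance-unique (P1.depth-isDistance v) (P2.depth-isDistance v)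

    parentCand≡ : ∀ v w → Ph1.parentCand v w ≡ Ph2.parentCand v w
    parentCand≡ v w rewrite leader-settled (guess i1) GD1 w | leader-settled (guess i1) GD1 v | leader-settled (guess i2) GD2 w | leader-settled (guess i2) GD2 v | depth≡ v | depth≡ w = refl

    parent≡ : ∀ v → Ph1.parent v ≡ Ph2.parent v
    parent≡ v = trans (cong (λ d → if d ≡ᵇ 0 then nothing else firstM (Ph1.parentCand v) (nbrs Gr v)) (depth≡ v))
                   (cong (λ z → if Ph2.depth v ≡ᵇ 0 then nothing else z) (firstM-congM (nbrs Gr v) (λ w _ → parentCand≡ v w)))

    ch≡ : ∀ w → Ph1.ch w ≡ Ph2.ch w
    ch≡ w = select-congM (nbrs Gr w) (λ c _ → cong (λ m → isPar ids m w) (parent≡ c))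

    cnt≡-budget : ∀ j h w → guess i2 ≤ Ph1.depth w + h → Ph1.cnt j w ≡ Ph2.cnt j w
    cnt≡-budget j h w p = trans (Ph1.cnt-rec j w) (trans (cong (Ph1.own j w +_) (trans (sumOver-congM (Ph1.ch w) (rec h p)) (cong (sumOver (Ph2.cnt j)) (ch≡ w))))
                       (sym (Ph2.cnt-rec j w)))
      where
      rec : ∀ h → guess i2 ≤ Ph1.depth w + h → ∀ c → c ∈ Ph1.ch w → Ph1.cnt j c ≡ Ph2.cnt j c
      rec zero p c m = ⊥-elim (Ph1.ch-nodeep (≤-trans i12 (≤-trans p (≤-reflexive (+-identityʳ _)))) m)
      rec (suc h') p c m = cnt≡-budget j h' c (≤-trans p (≤-reflexive (trans (+-suc _ h') (cong (_+ h') (sym (Ph1.ch-dep m))))))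

    cnt≡ : ∀ j w → Ph1.cnt j w ≡ Ph2.cnt j w
    cnt≡ j w = cnt≡-budget j (guess i2) w (m≤n+m _ _)

    off≡-depth : ∀ j d v → Ph1.depth v ≡ d → Ph1.off j v ≡ Ph2.off j v
    off≡-depth j d v e with Ph1.parent v in pe
    ... | nothing = trans (Ph1.off-root {j} {v} pe) (sym (Ph2.off-root {j} {v} (trans (sym (parent≡ v)) pe)))
    off≡-depth j zero v e | just w = ⊥-elim (0≢1+n (trans (sym e) (sym (Ph1.parent-dep v w pe))))
    off≡-depth j (suc d) v e | just w =
      trans (Ph1.off-rec {j} pe)
        (trans (cong₂ _+_ (cong (_+ Ph1.own j w) (off≡-depth j d w (suc-injective (trans (Ph1.parent-dep v w pe) e))))
                         (trans (sumBefore-congM ids (Ph1.ch w) v (λ c _ → cnt≡ j c)) (cong (λ xs → sumBefore ids (Ph2.cnt j) xs v) (ch≡ w))))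
        (sym (Ph2.off-rec {j} (trans (sym (parent≡ v)) pe))))

    off≡ : ∀ j v → Ph1.off j v ≡ Ph2.off j v
    off≡ j v = off≡-depth j (Ph1.depth v) v refl

    B≡ : ∀ j → P1.B j ≡ P2.B j
    B≡ zero = refl
    B≡ (suc j) = cong₂ _+_ (B≡ j) (cnt≡ j L)

    ID≡ : ∀ v → P1.ID v ≡ P2.ID v
    ID≡ v = cong suc (cong₂ _+_ (B≡ (Ph1.degClass v)) (off≡ (Ph1.degClass v) v))

    blk≡ : ∀ j → P1.blk j ≡ P2.blk j
    blk≡ zero = refl
    blk≡ (suc j) = cong₂ _++_ (blk≡ j) (cong (λ z → replicate z j) (cnt≡ j L))

    -- classes above guess i1 are empty, so the longer class table of phase i2 ends in
    -- empty blocks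
    classSize-empty : ∀ j → guess i1 < j → P2.classSize j ≡ 0
    classSize-empty j p = Ph2.cnt-zero j (λ u e → <⇒≱ p (≤-trans (≤-reflexive (sym e)) (P1.degClass-≤ u))) (guess i2) L (m≤n+m _ _)

    blk-empty-tail : ∀ m → P2.blk (suc (guess i1 + m)) ≡ P2.blk (suc (guess i1))
    blk-empty-tail zero rewrite +-identityʳ (guess i1) = refl
    blk-empty-tail (suc m) rewrite +-suc (guess i1) m | classSize-empty (suc (guess i1 + m)) (s≤s (m≤m+n _ m)) =
      trans (++-identityʳ _) (blk-empty-tail m)
      where open import Data.List.Properties using (++-identityʳ)

    info≡ : P1.info ≡ P2.info
    info≡ = trans (blk≡ (suc (guess i1))) (sym (trans (cong (λ z → P2.blk (suc z)) (sym (m+[n∸m]≡n i12))) (blk-empty-tail (guess i2 ∸ guess i1))))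

module Arithmetic where

  open TheAlgorithm using (phaseLen; guess)
  open Simulation using (phaseStart)
  open import Data.Nat
  open import Data.Nat.Properties
  open import Data.Nat.Logarithm
  open import Data.Empty using (⊥-elim)
  open import Data.Product using (_×_; _,_; ∃-syntax)
  open import Data.Sum using (inj₁; inj₂)
  open import Relation.Binary.PropositionalEquality
  open import Relation.Nullary using (yes; no)
  open import Data.Nat.Solver using (module +-*-Solver)
  open +-*-Solver

  pow-log-fuel : ∀ f m → m ≤ f → 0 < m → 2 ^ ⌊log₂ m ⌋ ≤ m
  pow-log-fuel f m p q with ⌊log₂ m ⌋ in e
  ... | zero = q
  pow-log-fuel f (suc zero) p q | suc L' = ⊥-elim (0≢1+n (trans (sym (⌊log₂[2^n]⌋≡n 0)) e))
  pow-log-fuel (suc f) (suc (suc m')) p q | suc L' =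
    ≤-trans (*-monoʳ-≤ 2 (≤-trans (≤-reflexive (cong (2 ^_) (sym eL))) ih))
      (≤-trans (≤-reflexive (cong (h +_) (+-identityʳ h))) (≤-trans (+-monoʳ-≤ h (⌊n/2⌋≤⌈n/2⌉ (suc (suc m'))))
        (≤-reflexive (⌊n/2⌋+⌈n/2⌉≡n (suc (suc m'))))))
    where
    h = ⌊ suc (suc m') /2⌋
    eL : ⌊log₂ h ⌋ ≡ L'
    eL = trans (⌊log₂⌊n/2⌋⌋≡⌊log₂n⌋∸1 (suc (suc m'))) (cong (_∸ 1) e)
    ih : 2 ^ ⌊log₂ h ⌋ ≤ h
    ih = pow-log-fuel f h (≤-pred (≤-trans (⌊n/2⌋<n (suc m')) p)) (s≤s z≤n)

  pow-log : ∀ m → 0 < m → 2 ^ ⌊log₂ m ⌋ ≤ m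
  pow-log m = pow-log-fuel m m ≤-refl

  lt-pow : ∀ m → m < 2 ^ (⌊log₂ m ⌋ + 1)
  lt-pow m with m <? 2 ^ (⌊log₂ m ⌋ + 1)
  ... | yes p = p
  ... | no p = ⊥-elim (<-irrefl refl (≤-trans (≤-reflexive (sym (trans (⌊log₂[2^n]⌋≡n (⌊log₂ m ⌋ + 1)) (+-comm _ 1))))
                                (⌊log₂⌋-mono-≤ (≮⇒≥ p))))

  -- phases have length 5G + 3 with doubling G, so phases 0..i take O(2^i) rounds
  phaseStart-bound : ∀ i → phaseStart (suc i) + 8 ≤ 8 * 2 ^ (suc i)
  phaseStart-bound zero = ≤-refl
  phaseStart-bound (suc i) = ≤-trans (≤-reflexive eq1) (≤-trans (+-monoˡ-≤ (phaseLen g) (phaseStart-bound i))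
                         (subst (λ z → 8 * z + phaseLen z ≤ 8 * (2 * z)) (sym gh) (polyB h)))
    where
    g = 2 ^ suc i
    h = pred g
    gh : g ≡ suc h
    gh = sym (suc-pred g ⦃ >-nonZero (m^n>0 2 (suc i)) ⦄)
    eq1 : phaseStart (suc (suc i)) + 8 ≡ (phaseStart (suc i) + 8) + phaseLen g
    eq1 = trans (+-assoc (phaseStart (suc i)) (phaseLen g) 8) (trans (cong (phaseStart (suc i) +_) (+-comm (phaseLen g) 8)) (sym (+-assoc (phaseStart (suc i)) 8 (phaseLen g))))
    polyB : ∀ h → 8 * suc h + phaseLen (suc h) ≤ 8 * (2 * suc h)
    polyB h = ≤-trans (m≤m+n _ (3 * h)) (≤-reflexive (solve 1 (λ h →
       ((con 8 :* (con 1 :+ h)) :+ (con 1 :+ ((con 1 :+ ((con 1 :+ h) :+ ((con 1 :+ h) :+ (con 1 :+ h)))) :+ (con 1 :+ ((con 1 :+ h) :+ (con 1 :+ h)))))) :+ con 3 :* h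
         := con 8 :* (con 2 :* (con 1 :+ h))) refl h))

  phaseOf : ∀ r → ∃[ i ] ∃[ s ] (r ≡ phaseStart i + s × s < phaseLen (guess i))
  phaseOf zero = 0 , 0 , refl , s≤s z≤n
  phaseOf (suc r) with phaseOf r
  ... | i , s , e , p with suc s <? phaseLen (guess i)
  ...   | yes q = i , suc s , trans (cong suc e) (sym (+-suc (phaseStart i) s)) , q
  ...   | no q = suc i , 0 , trans (cong suc e) (trans (sym (+-suc (phaseStart i) s))
                   (trans (cong (phaseStart i +_) (≤-antisym p (≮⇒≥ q))) (sym (+-identityʳ _)))) , s≤s z≤n

  phaseStart-mono : ∀ {i i'} → i ≤ i' → phaseStart i ≤ phaseStart i'
  phaseStart-mono {i} {i'} p with m≤n⇒m<n∨m≡n p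
  ... | inj₂ refl = ≤-refl
  phaseStart-mono {i} {suc i'} p | inj₁ (s≤s q) = ≤-trans (phaseStart-mono q) (m≤m+n _ _)

  in-phase : ∀ i s → s < phaseLen (guess i) → phaseStart i + s < phaseStart (suc i)
  in-phase i s p = +-monoʳ-< (phaseStart i) p

  phase-ge : ∀ i s i0 → s < phaseLen (guess i) → phaseStart (suc i0) ≤ phaseStart i + s → suc i0 ≤ i
  phase-ge i s i0 p q with suc i0 ≤? i
  ... | yes r = r
  ... | no r = ⊥-elim (<⇒≱ (≤-trans (in-phase i s p) (phaseStart-mono {suc i} {suc i0} (≰⇒> r))) q)

  guess-mono : ∀ {i i'} → i ≤ i' → guess i ≤ guess i'
  guess-mono p = ^-monoʳ-≤ 2 p

  -- a paired message is less than B^5 where B = 2^(⌊log₂ n⌋ + 1) > n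
  quintic : ∀ b → let B = suc (suc b) in B + (B + B) * (B + B) ≤ B * (B * (B * (B * (B * 1))))
  quintic b = ≤-trans (m≤m+n _ _) (≤-reflexive (solve 1 (λ b →
    ((con 2 :+ b) :+ ((con 2 :+ b) :+ (con 2 :+ b)) :* ((con 2 :+ b) :+ (con 2 :+ b)))
     :+ (b :* b :* b :* b :* b :+ con 10 :* (b :* b :* b :* b) :+ con 40 :* (b :* b :* b) :+ con 76 :* (b :* b) :+ con 63 :* b :+ con 14)
    := (con 2 :+ b) :* ((con 2 :+ b) :* ((con 2 :+ b) :* ((con 2 :+ b) :* ((con 2 :+ b) :* con 1))))) refl b))

  msgBnd-bits : ∀ n → n + (n + n) * (n + n) < 2 ^ (5 * (⌊log₂ n ⌋ + 1))
  msgBnd-bits n = ≤-trans (+-mono-<-≤ nB (*-mono-≤ (+-mono-≤ (<⇒≤ nB) (<⇒≤ nB)) (+-mono-≤ (<⇒≤ nB) (<⇒≤ nB))))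
                 (≤-trans (big B (B≥2)) (≤-reflexive (trans (^-*-assoc 2 (⌊log₂ n ⌋ + 1) 5) (cong (2 ^_) (*-comm (⌊log₂ n ⌋ + 1) 5)))))
    where
    B = 2 ^ (⌊log₂ n ⌋ + 1)
    nB : n < B
    nB = lt-pow n
    B≥2 : 2 ≤ B
    B≥2 = ^-monoʳ-≤ 2 {1} {⌊log₂ n ⌋ + 1} (≤-trans (s≤s z≤n) (≤-reflexive (+-comm 1 ⌊log₂ n ⌋)))
    big : ∀ x → 2 ≤ x → x + (x + x) * (x + x) ≤ x ^ 5
    big (suc (suc b)) _ = quintic b
    big (suc zero) (s≤s ())

module MainProof where

  open import Defs
  open Flooding
  open TheAlgorithm
  open Simulation
  open PhaseAnalysis
  open StablePhases
  open Arithmetic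
  open import Data.Nat
  open import Data.Nat.Properties
  open import Data.Nat.Logarithm using (⌊log₂_⌋)
  open import Data.Bool using (T)
  open import Data.Empty using (⊥-elim)
  open import Data.Fin using (Fin; zero; suc)
  open import Data.Fin.Properties using (¬Fin0)
  open import Data.Maybe using (just)
  open import Data.Product using (_×_; _,_; proj₁; proj₂; ∃-syntax; Σ-syntax)
  open import Data.Sum using (inj₁; inj₂)
  open import Function using (Injective; _∘_)
  open import Relation.Binary.PropositionalEquality
  open import Relation.Nullary using (yes; no)

  -- a vertex of minimum identifier: the leader elected by flooding
  minimumVertex : ∀ n (ids : Fin (suc n) → ℕ) → ∃[ L ] (∀ u → ids L ≤ ids u)
  minimumVertex zero ids = zero , λ { zero → ≤-refl }
  minimumVertex (suc n) ids with minimumVertex n (ids ∘ suc)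
  ... | L , h with ids zero ≤? ids (suc L)
  ...   | yes p = zero , λ { zero → ≤-refl ; (suc u) → ≤-trans p (h u) }
  ...   | no p = suc L , λ { zero → <⇒≤ (≰⇒> p) ; (suc u) → h u }

  GuaranteeFor : ℕ → Algorithm → ℕ → ℕ → Set
  GuaranteeFor k A c n = (G : Graph n) (D : ℕ) → IsDiameter G D →
       (ids : Fin n → ℕ) → Injective _≡_ _≡_ ids → (∀ v → Bits≤ k n (ids v)) →
       Σ[ t ∈ ℕ ] Σ[ ID ∈ (Fin n → ℕ) ] Σ[ info ∈ (Fin n → Info A) ]
         (t ≤ c * (D + ⌊log₂ n ⌋ + 1)
         × (∀ r → r < t → ∀ w v → T (adj G w v) → Bits≤ c n (Run.msg A G ids r w v))
         × (∀ r v → t ≤ r → out A (Run.state A G ids r v) ≡ just (ID v , info v))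
         × (∀ v → 1 ≤ ID v × ID v ≤ n)
         × Injective _≡_ _≡_ ID
         × (∀ i → 1 ≤ i → i ≤ n → ∃[ v ] ID v ≡ i)
         × (∀ u v → ID u < ID v → ⌊log₂ deg G u ⌋ ≤ ⌊log₂ deg G v ⌋)
         × (∀ u v → decode A (info u) (ID v) ≡ ⌊log₂ deg G v ⌋))

  emptyGraph : ∀ k A c → GuaranteeFor k A c 0
  emptyGraph k A c Gr D diam ids inj bits =
    0 , (λ ()) , (λ ()) , z≤n , (λ r ()) , (λ r ()) , (λ ()) , (λ {x} → ⊥-elim (¬Fin0 x)) ,
    (λ i p q → ⊥-elim (1+n≰n (≤-trans p q))) , (λ ()) , (λ ())

  module Nonempty (k n' : ℕ) (Gr : Graph (suc n')) (D : ℕ) (diam : IsDiameter Gr D)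
                  (ids : Fin (suc n') → ℕ) (inj : ∀ x y → ids x ≡ ids y → x ≡ y) where
    open Run alg Gr ids using (state; msg)

    n c lg m : ℕ
    n = suc n'
    c = k + 40
    lg = ⌊log₂ n ⌋
    m = D + lg + 1

    L : Fin n
    L = proj₁ (minimumVertex n' ids)

    -- from phase i0 on, the guess exceeds D + ⌊log n⌋
    i0 : ℕ
    i0 = suc ⌊log₂ m ⌋

    large : ∀ i → i0 ≤ i → D ≤ guess i × lg ≤ guess i
    large i p = ≤-trans (m≤m+n D lg) m≤guess , ≤-trans (m≤n+m lg D) m≤guess
      where
      m≤guess : D + lg ≤ guess i
      m≤guess = ≤-trans (m≤m+n (D + lg) 1)
                  (≤-trans (<⇒≤ (subst (m <_) (cong (2 ^_) (+-comm ⌊log₂ m ⌋ 1)) (lt-pow m))) (guess-mono p))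

    module Large (i : ℕ) (p : i0 ≤ i) =
      LargePhase Gr ids inj D diam L (proj₂ (minimumVertex n' ids)) i (proj₁ (large i p)) (proj₂ (large i p))
    module Final = Large i0 ≤-refl

    module Agree (i : ℕ) (p : i0 ≤ i) =
      PhaseAgreement Gr ids inj D diam L (proj₂ (minimumVertex n' ids)) i0 (proj₁ (large i0 ≤-refl)) (proj₂ (large i0 ≤-refl))
                     i (proj₁ (large i p)) (proj₂ (large i p)) (guess-mono p)

    stopTime : ℕ
    stopTime = phaseStart (suc i0)

    stopTime-bound : stopTime ≤ c * m
    stopTime-bound = begin
      stopTime                          ≤⟨ m≤m+n stopTime 8 ⟩
      stopTime + 8                      ≤⟨ phaseStart-bound i0 ⟩
      8 * (2 * (2 * 2 ^ ⌊log₂ m ⌋))     ≤⟨ *-monoʳ-≤ 8 (*-monoʳ-≤ 2 (*-monoʳ-≤ 2 (pow-log m (m≤n+m 1 (D + lg))))) ⟩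
      8 * (2 * (2 * m))                 ≡⟨ trans (sym (*-assoc 8 2 (2 * m))) (sym (*-assoc 16 2 m)) ⟩
      32 * m                            ≤⟨ *-monoˡ-≤ m (≤-trans (m≤m+n 32 8) (m≤n+m 40 k)) ⟩
      c * m                             ∎
      where open ≤-Reasoning

    widen : ∀ a → a ≤ c → 2 ^ (a * (lg + 1)) ≤ 2 ^ (c * (lg + 1))
    widen a p = ^-monoʳ-≤ 2 (*-monoˡ-≤ (lg + 1) p)

    messages-small : (∀ v → Bits≤ k n (ids v)) → ∀ r w v → T (adj Gr w v) → Bits≤ c n (msg r w v)
    messages-small bits r w v a with phaseOf r
    ... | i , s , refl , q with Phase.msgBound Gr ids inj i s q w v (WalkFacts.adj⇒nbr Gr a)
    ...   | inj₁ (u , eu) rewrite eu = ≤-trans (bits u) (widen k (m≤m+n k 40))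
    ...   | inj₂ le = ≤-trans (s≤s le) (≤-trans (msgBnd-bits n) (widen 5 (≤-trans (m≤m+n 5 35) (m≤n+m 40 k))))

    output-after : ∀ i s → s < phaseLen (guess i) → suc i0 ≤ i → ∀ v →
      NodeState.res (state (phaseStart i + s) v) ≡ just (Final.ID v , Final.info)
    output-after (suc i) s q le v with Replay.Good.g-res (Replay.replay Gr ids inj (suc i) s q v)
    ... | t , ok , er = trans er (cong just (trans (resF-≡ _ _ _ t)
         (trans (Large.phase-result i (≤-pred le) v t ok)
                (sym (cong₂ _,_ (Agree.ID≡ i (≤-pred le) v) (Agree.info≡ i (≤-pred le)))))))

    output-stable : ∀ r v → stopTime ≤ r → out alg (state r v) ≡ just (Final.ID v , Final.info)
    output-stable r v p with phaseOf r
    ... | i , s , refl , q = output-after i s q (phase-ge i s i0 q p) v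

    ID-range : ∀ v → 1 ≤ Final.ID v × Final.ID v ≤ n
    ID-range v = s≤s z≤n , subst (Final.ID v ≤_) Final.Tot-≡ (Final.ID-≤Tot v)

    ID-onto : ∀ x → 1 ≤ x → x ≤ n → ∃[ v ] Final.ID v ≡ x
    ID-onto x p q = Final.ID-surj x p (subst (x ≤_) (sym Final.Tot-≡) q)

  nonemptyGraph : ∀ k n' → GuaranteeFor k alg (k + 40) (suc n')
  nonemptyGraph k n' Gr D diam ids inj bits =
    stopTime , Final.ID , (λ _ → Final.info) , stopTime-bound , (λ r _ → messages-small bits r) , output-stable ,
    ID-range , (λ {x} {y} → Final.ID-inj x y) , ID-onto , Final.ID-mono , (λ _ v → Final.decode-ok v)
    where open Nonempty k n' Gr D diam ids (λ x y e → inj e)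

open TheAlgorithm using (alg)
open MainProof using (emptyGraph; nonemptyGraph)

lemma18 : (k : ℕ) → Σ[ A ∈ Algorithm ] Σ[ c ∈ ℕ ]
    ((n : ℕ) (G : Graph n) (D : ℕ) → IsDiameter G D →
    (ids : Fin n → ℕ) → Injective _≡_ _≡_ ids → (∀ v → Bits≤ k n (ids v)) →
    Σ[ t ∈ ℕ ] Σ[ ID ∈ (Fin n → ℕ) ] Σ[ info ∈ (Fin n → Info A) ]
    (t ≤ c * (D + ⌊log₂ n ⌋ + 1)
    × (∀ r → r < t → ∀ w v → T (adj G w v) → Bits≤ c n (Run.msg A G ids r w v))
    × (∀ r v → t ≤ r → out A (Run.state A G ids r v) ≡ just (ID v , info v))
    × (∀ v → 1 ≤ ID v × ID v ≤ n)
    × Injective _≡_ _≡_ ID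
    × (∀ i → 1 ≤ i → i ≤ n → ∃[ v ] ID v ≡ i)
    × (∀ u v → ID u < ID v → ⌊log₂ deg G u ⌋ ≤ ⌊log₂ deg G v ⌋)
    × (∀ u v → decode A (info u) (ID v) ≡ ⌊log₂ deg G v ⌋)))
lemma18 k = alg , k + 40 , λ where
  zero     → emptyGraph k alg (k + 40)
  (suc n') → nonemptyGraph k n'
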